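{- Let $q\ge 4$ be a prime power and let $\mathcal{B}$ be a minimal blocking set in $\mathrm{PG}(2,q)$ built with a $(2q-1)$-construction. Then $\mathcal{B}$ does not have the $r_\infty$-property with respect to any of its points.
   Context: A blocking set of $\mathrm{PG}(2,q)$ is a set of points meeting every line and containing no line; minimal if no proper subset is a blocking set. A line is tangent to a point set $\mathcal{K}$ if it meets $\mathcal{K}$ in exactly one point, secant if in more than one. $\mathcal{B}$ has the $r_\infty$-property with respect to $P\in\mathcal{B}$ if exactly one line through $P$ is tangent to $\mathcal{B}$ and all other lines through $P$ are secants. $k$-construction (for $q\ge4$): let $a,b,c$ be non-concurrent lines, $C=a\cap b$, $B=a\cap c$, $A=b\cap c$, and let $\mathcal{T}$ be the vertexless triangle (points on exactly one of $a,b,c$). Choose a line $\ell$ through $A$ different from $b,c$, put $A'=\ell\cap a$, and choose $D_1\in\ell\setminus\{A,A'\}$. Put $B_1=BD_1\cap b$. If $q$ is odd, let $D_2=CC_2\cap\ell$ where $C_2=A'B_1\cap c$; if $q$ is even, choose $D_2\in\ell\setminus\{A,A',D_1\}$. Choose further distinct points $D_3,\dots,D_n\in\ell\setminus\{A,A'\}$ different from $D_1,D_2$, with $2\le n\le q-2$. For each $i$ let $B_i=BD_i\cap b$, $C_i=CD_i\cap c$. Then $\mathcal{B}=(\mathcal{T}\cup\{D_1,\dots,D_n\})\setminus\{B_1,\dots,B_n,C_1,\dots,C_n\}$ is a minimal blocking set of size $k=3q-3-n$, said to be built with a $k$-construction. A $(2q-1)$-construction is the case $n=q-2$. -}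

module Defs where

open import Data.Nat as ℕ using (ℕ; _^_; _≤_)
open import Data.Nat.Primality using (Prime)
open import Data.Nat.Divisibility using (_∣_)
open import Data.Fin using (Fin)
open import Data.Product using (Σ; ∃; ∃-syntax; _×_; _,_)
open import Data.Sum using (_⊎_)
open import Relation.Nullary using (¬_)
open import Relation.Binary.PropositionalEquality using (_≡_; _≢_)
open import Function.Bundles using (_↔_)
open import Function.Definitions using (Injective)
open import Algebra.Structures using (IsCommutativeRing)

IsPrimePower : ℕ → Set
IsPrimePower q = ∃[ p ] ∃[ k ] (Prime p × 1 ≤ k × q ≡ p ^ k)

record FiniteField (q : ℕ) : Set₁ where
  infixl 6 _+_
  infixl 7 _*_
  field
    Carrier : Set
    _+_ _*_ : Carrier → Carrier → Carrier
    -_      : Carrier → Carrier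
    0# 1#   : Carrier
    isCommutativeRing : IsCommutativeRing _≡_ _+_ _*_ -_ 0# 1#
    0≢1     : 0# ≢ 1#
    inverse : ∀ x → x ≢ 0# → ∃[ y ] (x * y ≡ 1#)
    enumeration : Carrier ↔ Fin q

-- The projective plane PG(2,F) in homogeneous coordinates, with every point
-- (and every line) represented by its unique normalised coordinate vector:
-- the first non-zero coordinate equals 1.
module PG2 {q : ℕ} (F : FiniteField q) where
  open FiniteField F

  Vec3 : Set
  Vec3 = Carrier × Carrier × Carrier

  Normalised : Vec3 → Set
  Normalised (x , y , z) =
    (x ≡ 1#) ⊎ ((x ≡ 0# × y ≡ 1#) ⊎ (x ≡ 0# × y ≡ 0# × z ≡ 1#))

  Point : Set
  Point = Σ Vec3 Normalised

  Line : Set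
  Line = Σ Vec3 Normalised

  _on_ : Point → Line → Set
  ((x , y , z) , _) on ((u , v , w) , _) = u * x + v * y + w * z ≡ 0#

  Collinear : Point → Point → Point → Set
  Collinear X Y Z = ∃[ m ] (X on m × Y on m × Z on m)

  PointSet : Set₁
  PointSet = Point → Set

  Tangent : PointSet → Line → Set
  Tangent 𝓑 m = ∃[ X ] ((𝓑 X × X on m) × (∀ Y → 𝓑 Y → Y on m → Y ≡ X))

  Secant : PointSet → Line → Set
  Secant 𝓑 m = ∃[ X ] ∃[ Y ] (X ≢ Y × 𝓑 X × X on m × 𝓑 Y × Y on m)

  RInftyProperty : PointSet → Point → Set
  RInftyProperty 𝓑 P =
    ∃[ t ] ((P on t × Tangent 𝓑 t) × (∀ m → P on m → m ≢ t → Secant 𝓑 m))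

  -- Data of a (2q-1)-construction, i.e. a k-construction with n = q - 2.
  -- The points D_1,…,D_n are an injective family D indexed by Fin (q ∸ 2);
  -- i₁ and i₂ are the indices playing the roles of D_1 and D_2.
  record Construction : Set where
    field
      a b c : Line
      nonConcurrent : ∀ X → ¬ (X on a × X on b × X on c)
      A B C : Point
      C-on-a : C on a
      C-on-b : C on b
      B-on-a : B on a
      B-on-c : B on c
      A-on-b : A on b
      A-on-c : A on c
      ℓ : Line
      A-on-ℓ : A on ℓ
      ℓ≢b : ℓ ≢ b
      ℓ≢c : ℓ ≢ c
      A′ : Point
      A′-on-ℓ : A′ on ℓ
      A′-on-a : A′ on a
      D : Fin (q ℕ.∸ 2) → Point
      D-injective : Injective _≡_ _≡_ D
      D-on-ℓ : ∀ i → D i on ℓ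
      D≢A : ∀ i → D i ≢ A
      D≢A′ : ∀ i → D i ≢ A′
      i₁ i₂ : Fin (q ℕ.∸ 2)
      i₁≢i₂ : i₁ ≢ i₂
      -- q odd: D_2 = CC_2 ∩ ℓ, where C_2 = A'B_1 ∩ c and B_1 = BD_1 ∩ b
      odd-D₂ : ¬ (2 ∣ q) →
        ∃[ B₁ ] ∃[ C₂ ] ((B₁ on b × Collinear B (D i₁) B₁)
                        × (C₂ on c × Collinear A′ B₁ C₂)
                        × Collinear C C₂ (D i₂))

    𝓣 : PointSet
    𝓣 X = (X on a × ¬ X on b × ¬ X on c)
        ⊎ ((¬ X on a × X on b × ¬ X on c)
        ⊎ (¬ X on a × ¬ X on b × X on c))

    -- the points B_i = BD_i ∩ b and C_i = CD_i ∩ c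
    Removed : PointSet
    Removed X = ∃[ i ] ((X on b × Collinear B (D i) X)
                       ⊎ (X on c × Collinear C (D i) X))

    𝓑 : PointSet
    𝓑 X = (𝓣 X ⊎ ∃[ i ] (X ≡ D i)) × ¬ Removed X

-- The points of 𝓑 lie on a, b, c, or are the q − 2 points D i of ℓ; so ℓ consists of A, A′,
-- the D i and exactly one further point E. A line through B and a point Y of 𝓑 on b meets ℓ
-- in a point other than A, A′ and the D i (else Y would lie on c or a, or be a removed point
-- B i), hence in E: all of 𝓑 ∩ b lies on BE, and likewise 𝓑 ∩ c lies on CE. This gives two
-- tangents at every point P ≠ A′ of 𝓑: DB and DC at P = D i, PB and b at P on b (symmetrically
-- on c), PA and PE at P on a. At A′, if all lines but one tangent t were secants, every point
-- of b would be C, A, t ∩ b, BE ∩ b or the point of b on the line through A′ and CE ∩ c, so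
-- q + 1 ≤ 5 and q = 4. Then 1 + 1 = 0, and by Fano's theorem the diagonal points A′ = AE ∩ BC,
-- BE ∩ AC and CE ∩ AB of the quadrangle A B C E are collinear: the last two candidates
-- coincide and q + 1 ≤ 4.
-- Points and lines are handled in homogeneous coordinates, where incidence is a dot product and
-- the line through two points is their cross product.

module Submission where

open import Defs
open import Data.Nat as ℕ using (zero; suc; _≤_)
import Data.Nat.Properties as ℕ
open import Data.Integer as ℤ using (ℤ; -[1+_]; sign; ∣_∣; _◃_)
import Data.Integer.Properties as ℤ
open import Data.Sign as Sign using (Sign)
open import Data.Fin as Fin using (Fin; zero; suc)
import Data.Fin.Properties as Fin
open import Data.Vec.Functional using (_∷_; [])
open import Data.Product using (∃; ∃-syntax; _×_; _,_; proj₁; proj₂)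
open import Data.Product.Properties using (≡-dec; Σ-≡,≡→≡)
open import Data.Sum using (_⊎_; inj₁; inj₂; swap)
open import Data.Empty using (⊥; ⊥-elim)
open import Data.Unit using (⊤; tt)
import Data.Maybe as Maybe
open import Function using (_∘_)
open import Function.Bundles using (Inverse; Injection)
open import Function.Definitions using (Injective)
open import Function.Properties.Inverse using (↔⇒↣)
open import Relation.Unary using (Pred)
open import Relation.Nullary using (¬_; Dec; yes; no; Irrelevant)
open import Relation.Nullary.Decidable using (dec⇒maybe; via-injection)
open import Relation.Binary.Definitions using (DecidableEquality)
open import Axiom.UniquenessOfIdentityProofs using (UIP; module Decidable⇒UIP)
open import Relation.Binary.PropositionalEquality
  using (_≡_; _≢_; refl; sym; trans; cong; cong₂; subst; module ≡-Reasoning)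
open import Algebra.Bundles using (CommutativeRing)
open import Algebra.Solver.Ring.AlmostCommutativeRing
  using (fromCommutativeRing; _-Raw-AlmostCommutative⟶_)

cong₃ : ∀ {a b c d} {A : Set a} {B : Set b} {C : Set c} {D : Set d} (f : A → B → C → D)
  {x x′ y y′ z z′} → x ≡ x′ → y ≡ y′ → z ≡ z′ → f x y z ≡ f x′ y′ z′
cong₃ f refl refl refl = refl

cover-injective⇒≤ : ∀ {a p} {A : Set a} {P : Pred A p} {k n} (s : Fin k → A) →
  (∀ {x} → P x → ∃ λ i → x ≡ s i) →
  {e : Fin n → A} → Injective _≡_ _≡_ e → (∀ j → P (e j)) → n ≤ k
cover-injective⇒≤ s cover {e} e-injective e∈P = Fin.injective⇒≤ index-injective
  where
  index-injective : Injective _≡_ _≡_ (proj₁ ∘ cover ∘ e∈P)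
  index-injective {i} {j} eq = e-injective (begin
    e i                        ≡⟨ proj₂ (cover (e∈P i)) ⟩
    s (proj₁ (cover (e∈P i)))  ≡⟨ cong s eq ⟩
    s (proj₁ (cover (e∈P j)))  ≡⟨ proj₂ (cover (e∈P j)) ⟨
    e j                        ∎)
    where open ≡-Reasoning

[]-injective : ∀ {a} {A : Set a} → Injective _≡_ _≡_ ([] {A = A})
[]-injective {x = ()}

∷-injective : ∀ {a} {A : Set a} {n} {x : A} {f : Fin n → A} →
  Injective _≡_ _≡_ f → (∀ i → f i ≢ x) → Injective _≡_ _≡_ (x ∷ f)
∷-injective f-injective fresh {zero}  {zero}  _  = refl
∷-injective f-injective fresh {zero}  {suc j} eq = ⊥-elim (fresh j (sym eq))
∷-injective f-injective fresh {suc i} {zero}  eq = ⊥-elim (fresh i eq)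
∷-injective f-injective fresh {suc i} {suc j} eq = cong suc (f-injective eq)

-- The ring solver for an arbitrary commutative ring, whose equality need not be decidable by
-- computation, using integer coefficients n ↦ ±(n × 1#). With the optimised multiple, con 0
-- and con 1 evaluate to 0# and 1# definitionally.
module ℤ-Solver {c ℓ} (R : CommutativeRing c ℓ) where
  open CommutativeRing R hiding (refl; sym; trans)
  open CommutativeRing R using () renaming (refl to ≈-refl; sym to ≈-sym; trans to ≈-trans)
  open import Algebra.Properties.Ring ring
    using (-0#≈0#; -‿involutive; -‿+-comm; -‿anti-homo-+; -‿distribˡ-*; -‿distribʳ-*)
  open import Algebra.Properties.Semiring.Mult.TCOptimised semiring
    using (×-homo-+; ×1-homo-*; 1+×) renaming (_×_ to _×ₙ_)
  open import Relation.Binary.Reasoning.Setoid setoid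

  signed : Sign → Carrier → Carrier
  signed Sign.+ x = x
  signed Sign.- x = - x

  ⟦_⟧ : ℤ → Carrier
  ⟦ i ⟧ = signed (sign i) (∣ i ∣ ×ₙ 1#)

  signed-cong : ∀ s {x y} → x ≈ y → signed s x ≈ signed s y
  signed-cong Sign.+ x≈y = x≈y
  signed-cong Sign.- x≈y = -‿cong x≈y

  signed-* : ∀ s t x y → signed s x * signed t y ≈ signed (s Sign.* t) (x * y)
  signed-* Sign.+ Sign.+ x y = ≈-refl
  signed-* Sign.+ Sign.- x y = ≈-sym (-‿distribʳ-* x y)
  signed-* Sign.- Sign.+ x y = ≈-sym (-‿distribˡ-* x y)
  signed-* Sign.- Sign.- x y = begin
    - x * - y    ≈⟨ -‿distribˡ-* x (- y) ⟨
    - (x * - y)  ≈⟨ -‿cong (-‿distribʳ-* x y) ⟨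
    - - (x * y)  ≈⟨ -‿involutive (x * y) ⟩
    x * y        ∎

  ⟦◃⟧ : ∀ s n → ⟦ s ◃ n ⟧ ≈ signed s (n ×ₙ 1#)
  ⟦◃⟧ Sign.+ zero    = ≈-refl
  ⟦◃⟧ Sign.- zero    = ≈-sym -0#≈0#
  ⟦◃⟧ Sign.+ (suc n) = ≈-refl
  ⟦◃⟧ Sign.- (suc n) = ≈-refl

  [1+x]-[1+y]≈x-y : ∀ x y → (1# + x) - (1# + y) ≈ x - y
  [1+x]-[1+y]≈x-y x y = begin
    (1# + x) - (1# + y)      ≈⟨ +-congˡ (-‿anti-homo-+ 1# y) ⟩
    (1# + x) + (- y - 1#)    ≈⟨ +-congʳ (+-comm 1# x) ⟩
    (x + 1#) + (- y - 1#)    ≈⟨ +-assoc x 1# _ ⟩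
    x + (1# + (- y - 1#))    ≈⟨ +-congˡ (+-congˡ (+-comm (- y) (- 1#))) ⟩
    x + (1# + (- 1# + - y))  ≈⟨ +-congˡ (+-assoc 1# (- 1#) (- y)) ⟨
    x + ((1# - 1#) + - y)    ≈⟨ +-congˡ (+-congʳ (-‿inverseʳ 1#)) ⟩
    x + (0# + - y)           ≈⟨ +-congˡ (+-identityˡ (- y)) ⟩
    x - y                    ∎

  ⟦⊖⟧ : ∀ m n → ⟦ m ℤ.⊖ n ⟧ ≈ m ×ₙ 1# - n ×ₙ 1#
  ⟦⊖⟧ m       zero    = ≈-sym (≈-trans (+-congˡ -0#≈0#) (+-identityʳ _))
  ⟦⊖⟧ zero    (suc n) = ≈-sym (+-identityˡ _)
  ⟦⊖⟧ (suc m) (suc n) = begin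
    ⟦ suc m ℤ.⊖ suc n ⟧              ≡⟨ cong ⟦_⟧ (ℤ.[1+m]⊖[1+n]≡m⊖n m n) ⟩
    ⟦ m ℤ.⊖ n ⟧                      ≈⟨ ⟦⊖⟧ m n ⟩
    m ×ₙ 1# - n ×ₙ 1#                ≈⟨ [1+x]-[1+y]≈x-y _ _ ⟨
    (1# + m ×ₙ 1#) - (1# + n ×ₙ 1#)  ≈⟨ +-cong (1+× m 1#) (-‿cong (1+× n 1#)) ⟨
    suc m ×ₙ 1# - suc n ×ₙ 1#        ∎

  +-homo : ∀ i j → ⟦ i ℤ.+ j ⟧ ≈ ⟦ i ⟧ + ⟦ j ⟧
  +-homo (ℤ.+ m)  (ℤ.+ n)  = ×-homo-+ 1# m n
  +-homo (ℤ.+ m)  -[1+ n ] = ⟦⊖⟧ m (suc n)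
  +-homo -[1+ m ] (ℤ.+ n)  = ≈-trans (⟦⊖⟧ n (suc m)) (+-comm _ _)
  +-homo -[1+ m ] -[1+ n ] = begin
    - (suc (suc (m ℕ.+ n)) ×ₙ 1#)      ≡⟨ cong (λ k → - (suc k ×ₙ 1#)) (ℕ.+-suc m n) ⟨
    - ((suc m ℕ.+ suc n) ×ₙ 1#)        ≈⟨ -‿cong (×-homo-+ 1# (suc m) (suc n)) ⟩
    - (suc m ×ₙ 1# + suc n ×ₙ 1#)      ≈⟨ -‿+-comm _ _ ⟨
    - (suc m ×ₙ 1#) + - (suc n ×ₙ 1#)  ∎

  *-homo : ∀ i j → ⟦ i ℤ.* j ⟧ ≈ ⟦ i ⟧ * ⟦ j ⟧
  *-homo i j = begin
    ⟦ s ◃ ∣ i ∣ ℕ.* ∣ j ∣ ⟧               ≈⟨ ⟦◃⟧ s (∣ i ∣ ℕ.* ∣ j ∣) ⟩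
    signed s ((∣ i ∣ ℕ.* ∣ j ∣) ×ₙ 1#)    ≈⟨ signed-cong s (×1-homo-* ∣ i ∣ ∣ j ∣) ⟩
    signed s (∣ i ∣ ×ₙ 1# * ∣ j ∣ ×ₙ 1#)  ≈⟨ signed-* (sign i) (sign j) _ _ ⟨
    ⟦ i ⟧ * ⟦ j ⟧                         ∎
    where s = sign i Sign.* sign j

  -‿homo : ∀ i → ⟦ ℤ.- i ⟧ ≈ - ⟦ i ⟧
  -‿homo (ℤ.+ zero) = ≈-sym -0#≈0#
  -‿homo ℤ.+[1+ n ] = ≈-refl
  -‿homo -[1+ n ]   = ≈-sym (-‿involutive _)

  homomorphism : CommutativeRing.rawRing ℤ.+-*-commutativeRing
                   -Raw-AlmostCommutative⟶ fromCommutativeRing R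
  homomorphism = record
    { ⟦_⟧ = ⟦_⟧ ; +-homo = +-homo ; *-homo = *-homo ; -‿homo = -‿homo
    ; 0-homo = ≈-refl ; 1-homo = ≈-refl }

  open import Algebra.Solver.Ring _ _ homomorphism
    (λ i j → Maybe.map (reflexive ∘ cong ⟦_⟧) (dec⇒maybe (i ℤ.≟ j))) public
    using (solve; _:=_; _:+_; _:*_; :-_; con; Polynomial)

-- Generic in the ring operations, so that the same expressions can be built from solver polynomials.
module Vec3-Operations {a} {A : Set a} (_+_ _*_ : A → A → A) (-_ : A → A) where
  infixl 6 _⊕_ _⊖_
  infix  7 _·_
  infixr 8 _⋆_
  infixl 9 _⨯_

  _·_ : A × A × A → A × A × A → A
  (u₁ , u₂ , u₃) · (v₁ , v₂ , v₃) = ((u₁ * v₁) + (u₂ * v₂)) + (u₃ * v₃)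

  _⨯_ : A × A × A → A × A × A → A × A × A
  (u₁ , u₂ , u₃) ⨯ (v₁ , v₂ , v₃) =
    (u₂ * v₃) + (- (u₃ * v₂)) , (u₃ * v₁) + (- (u₁ * v₃)) , (u₁ * v₂) + (- (u₂ * v₁))

  _⋆_ : A → A × A × A → A × A × A
  k ⋆ (u₁ , u₂ , u₃) = k * u₁ , k * u₂ , k * u₃

  _⊕_ _⊖_ : A × A × A → A × A × A → A × A × A
  (u₁ , u₂ , u₃) ⊕ (v₁ , v₂ , v₃) = u₁ + v₁ , u₂ + v₂ , u₃ + v₃
  (u₁ , u₂ , u₃) ⊖ (v₁ , v₂ , v₃) = u₁ + (- v₁) , u₂ + (- v₂) , u₃ + (- v₃)

  det : A × A × A → A × A × A → A × A × A → A
  det u v w = (u ⨯ v) · w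

  coords¹ : ∀ {b} {B : Set b} → (A × A × A → B) → A → A → A → B
  coords¹ f x₁ x₂ x₃ = f (x₁ , x₂ , x₃)

  coords² : ∀ {b} {B : Set b} → (A × A × A → A × A × A → B) → A → A → A → A → A → A → B
  coords² f x₁ x₂ x₃ = coords¹ (f (x₁ , x₂ , x₃))

  coords³ : ∀ {b} {B : Set b} → (A × A × A → A × A × A → A × A × A → B) →
            A → A → A → A → A → A → A → A → A → B
  coords³ f x₁ x₂ x₃ = coords² (f (x₁ , x₂ , x₃))

  coords⁴ : ∀ {b} {B : Set b} → (A × A × A → A × A × A → A × A × A → A × A × A → B) →
            A → A → A → A → A → A → A → A → A → A → A → A → B
  coords⁴ f x₁ x₂ x₃ = coords³ (f (x₁ , x₂ , x₃))

module Field {q} (F : FiniteField q) where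
  open FiniteField F public

  commutativeRing : CommutativeRing _ _
  commutativeRing = record { isCommutativeRing = isCommutativeRing }

  open CommutativeRing commutativeRing public
    using (+-identityʳ; -‿inverseʳ; *-assoc; *-comm; *-identityˡ; *-identityʳ; zeroˡ; zeroʳ; distribʳ)
  open import Algebra.Properties.Ring (CommutativeRing.ring commutativeRing) public
    using (-0#≈0#; -‿involutive; -‿injective; -‿distribˡ-*; x∙y⁻¹≈ε⇒x≈y)
  open ℤ-Solver commutativeRing public using (solve; _:=_; _:+_; _:*_; :-_; con; Polynomial)
  open Inverse enumeration public using (to; from; strictlyInverseˡ; strictlyInverseʳ)
  open ≡-Reasoning

  infix 4 _≟_
  _≟_ : DecidableEquality Carrier
  _≟_ = via-injection (↔⇒↣ enumeration) Fin._≟_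

  1≢0 : 1# ≢ 0#
  1≢0 = 0≢1 ∘ sym

  inv : ∀ x → x ≢ 0# → Carrier
  inv x x≢0 = proj₁ (inverse x x≢0)

  *-inverseʳ : ∀ {x} (x≢0 : x ≢ 0#) → x * inv x x≢0 ≡ 1#
  *-inverseʳ {x} x≢0 = proj₂ (inverse x x≢0)

  *-inverseˡ : ∀ {x} (x≢0 : x ≢ 0#) → inv x x≢0 * x ≡ 1#
  *-inverseˡ {x} x≢0 = trans (*-comm _ x) (*-inverseʳ x≢0)

  inv-≢0 : ∀ {x} (x≢0 : x ≢ 0#) → inv x x≢0 ≢ 0#
  inv-≢0 {x} x≢0 inv≡0 = 1≢0 (begin
    1#             ≡⟨ *-inverseʳ x≢0 ⟨
    x * inv x x≢0  ≡⟨ cong (x *_) inv≡0 ⟩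
    x * 0#         ≡⟨ zeroʳ x ⟩
    0#             ∎)

  x*y≡0⇒y≡0 : ∀ {x y} → x ≢ 0# → x * y ≡ 0# → y ≡ 0#
  x*y≡0⇒y≡0 {x} {y} x≢0 xy≡0 = begin
    y                    ≡⟨ *-identityˡ y ⟨
    1# * y               ≡⟨ cong (_* y) (*-inverseʳ x≢0) ⟨
    x * inv x x≢0 * y    ≡⟨ cong (_* y) (*-comm x _) ⟩
    inv x x≢0 * x * y    ≡⟨ *-assoc _ x y ⟩
    inv x x≢0 * (x * y)  ≡⟨ cong (inv x x≢0 *_) xy≡0 ⟩
    inv x x≢0 * 0#       ≡⟨ zeroʳ _ ⟩
    0#                   ∎

  x-x/y*y≡0 : ∀ x {y} (y≢0 : y ≢ 0#) → x + - (x * inv y y≢0) * y ≡ 0#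
  x-x/y*y≡0 x {y} y≢0 = begin
    x + - (x * inv y y≢0) * y    ≡⟨ cong (x +_) (-‿distribˡ-* _ y) ⟨
    x + - (x * inv y y≢0 * y)    ≡⟨ cong (λ z → x + - z) (*-assoc x _ y) ⟩
    x + - (x * (inv y y≢0 * y))  ≡⟨ cong (λ z → x + - (x * z)) (*-inverseˡ y≢0) ⟩
    x + - (x * 1#)               ≡⟨ cong (λ z → x + - z) (*-identityʳ x) ⟩
    x + - x                      ≡⟨ -‿inverseʳ x ⟩
    0#                           ∎

  w*c≡v*d⇒w≡v/c*d : ∀ {w c v d} (c≢0 : c ≢ 0#) → w * c ≡ v * d → w ≡ v * inv c c≢0 * d
  w*c≡v*d⇒w≡v/c*d {w} {c} {v} {d} c≢0 wc≡vd = begin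
    w                    ≡⟨ *-identityʳ w ⟨
    w * 1#               ≡⟨ cong (w *_) (*-inverseʳ c≢0) ⟨
    w * (c * inv c c≢0)  ≡⟨ *-assoc w c _ ⟨
    w * c * inv c c≢0    ≡⟨ cong (_* inv c c≢0) wc≡vd ⟩
    v * d * inv c c≢0    ≡⟨ *-assoc v d _ ⟩
    v * (d * inv c c≢0)  ≡⟨ cong (v *_) (*-comm d _) ⟩
    v * (inv c c≢0 * d)  ≡⟨ *-assoc v _ d ⟨
    v * inv c c≢0 * d    ∎

  x+x≡0 : 1# + 1# ≡ 0# → ∀ x → x + x ≡ 0#
  x+x≡0 2≡0 x = begin
    x + x            ≡⟨ cong₂ _+_ (*-identityˡ x) (*-identityˡ x) ⟨
    1# * x + 1# * x  ≡⟨ distribʳ x 1# 1# ⟨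
    (1# + 1#) * x    ≡⟨ cong (_* x) 2≡0 ⟩
    0# * x           ≡⟨ zeroˡ x ⟩
    0#               ∎

  x-y≡0⇒x≡y : ∀ {x y} → x + - y ≡ 0# → x ≡ y
  x-y≡0⇒x≡y = x∙y⁻¹≈ε⇒x≈y _ _

  -x≡y⇒x≡-y : ∀ {x y} → - x ≡ y → x ≡ - y
  -x≡y⇒x≡-y {x} -x≡y = trans (sym (-‿involutive x)) (cong -_ -x≡y)

  -‿≢0 : ∀ {x} → x ≢ 0# → - x ≢ 0#
  -‿≢0 x≢0 -x≡0 = x≢0 (trans (-x≡y⇒x≡-y -x≡0) -0#≈0#)

  -x≢x : 1# + 1# ≢ 0# → ∀ {x} → x ≢ 0# → - x ≢ x
  -x≢x 2≢0 {x} x≢0 -x≡x = x≢0 (x*y≡0⇒y≡0 2≢0 (begin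
    (1# + 1#) * x    ≡⟨ distribʳ x 1# 1# ⟩
    1# * x + 1# * x  ≡⟨ cong₂ _+_ (*-identityˡ x) (trans (*-identityˡ x) (sym -x≡x)) ⟩
    x + - x          ≡⟨ -‿inverseʳ x ⟩
    0#               ∎))

  injective⇒≤q : ∀ {n} {e : Fin n → Carrier} → Injective _≡_ _≡_ e → n ≤ q
  injective⇒≤q e-injective = Fin.injective⇒≤ (e-injective ∘ Injection.injective (↔⇒↣ enumeration))

  from-injective : Injective _≡_ _≡_ from
  from-injective {i} {j} eq = trans (sym (strictlyInverseˡ i)) (trans (cong to eq) (strictlyInverseˡ j))

  covering⇒q≤ : ∀ {k} (s : Fin k → Carrier) → (∀ x → ∃ λ i → x ≡ s i) → q ≤ k
  covering⇒q≤ s cover = cover-injective⇒≤ {P = λ _ → ⊤} s (λ {x} _ → cover x) from-injective (λ _ → tt)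

  -- If 1 + 1 ≢ 0, then x ↦ - x fixes only 0, so a fourth element x ∉ {0, 1, - 1} brings a fifth, - x.
  char≢2⇒q≢4 : 1# + 1# ≢ 0# → q ≢ 4
  char≢2⇒q≢4 2≢0 q≡4 = outside-0-±1 λ x x≢0 x≢1 x≢-1 →
    ℕ.<-irrefl (sym q≡4) (injective⇒≤q (five-distinct x≢0 x≢1 x≢-1))
    where
    outside-0-±1 : (∀ x → x ≢ 0# → x ≢ 1# → x ≢ - 1# → ⊥) → ⊥
    outside-0-±1 none = ℕ.<-irrefl q≡4 (ℕ.s≤s (covering⇒q≤ (0# ∷ 1# ∷ - 1# ∷ []) cover))
      where
      cover : ∀ x → ∃ λ i → x ≡ (0# ∷ 1# ∷ - 1# ∷ []) i
      cover x with x ≟ 0# | x ≟ 1# | x ≟ - 1#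
      ... | yes x≡0 | _       | _        = zero , x≡0
      ... | no _    | yes x≡1 | _        = suc zero , x≡1
      ... | no _    | no _    | yes x≡-1 = suc (suc zero) , x≡-1
      ... | no x≢0  | no x≢1  | no x≢-1  = ⊥-elim (none x x≢0 x≢1 x≢-1)
    five-distinct : ∀ {x} → x ≢ 0# → x ≢ 1# → x ≢ - 1# →
                    Injective _≡_ _≡_ (0# ∷ 1# ∷ - 1# ∷ x ∷ - x ∷ [])
    five-distinct {x} x≢0 x≢1 x≢-1 =
      ∷-injective (∷-injective (∷-injective (∷-injective (∷-injective []-injective λ ())
        λ { zero → -x≢x 2≢0 x≢0 })
        λ { zero → x≢-1 ; (suc zero) → x≢1 ∘ -‿injective })
        λ { zero → -x≢x 2≢0 1≢0 ; (suc zero) → x≢1 ; (suc (suc zero)) → x≢-1 ∘ -x≡y⇒x≡-y })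
        λ { zero → 1≢0 ; (suc zero) → -‿≢0 1≢0 ; (suc (suc zero)) → x≢0
          ; (suc (suc (suc zero))) → -‿≢0 x≢0 }

  order-4⇒char-2 : q ≡ 4 → 1# + 1# ≡ 0#
  order-4⇒char-2 q≡4 with (1# + 1#) ≟ 0#
  ... | yes 2≡0 = 2≡0
  ... | no 2≢0  = ⊥-elim (char≢2⇒q≢4 2≢0 q≡4)

module Vectors {q} (F : FiniteField q) where
  open Field F public
  open PG2 F public using (Vec3)
  open Vec3-Operations _+_ _*_ -_ public using (_·_; _⨯_; _⋆_; _⊕_; _⊖_; det)
  private
    module Pol {n} = Vec3-Operations {A = Polynomial n} _:+_ _:*_ :-_
  open Pol using (coords¹; coords²; coords³; coords⁴)
    renaming (_·_ to _:·_; _⨯_ to _:⨯_; _⋆_ to _:⋆_; _⊕_ to _:⊕_; _⊖_ to _:⊖_; det to :det)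
  open ≡-Reasoning

  0⃗ : Vec3
  0⃗ = 0# , 0# , 0#

  ≡³ : ∀ {x y z x′ y′ z′ : Carrier} → x ≡ x′ → y ≡ y′ → z ≡ z′ → (x , y , z) ≡ (x′ , y′ , z′)
  ≡³ refl refl refl = refl

  private
    :0 :1 : ∀ {n} → Polynomial n
    :0 = con (ℤ.+ 0)
    :1 = con (ℤ.+ 1)

  ≡³⁻¹ : ∀ {x y z x′ y′ z′ : Carrier} → (x , y , z) ≡ (x′ , y′ , z′) → x ≡ x′ × y ≡ y′ × z ≡ z′
  ≡³⁻¹ refl = refl , refl , refl

  ·-basis : ∀ x y z → ((x , y , z) · (1# , 0# , 0#) ≡ x) × ((x , y , z) · (0# , 1# , 0#) ≡ y)
                                                       × ((x , y , z) · (0# , 0# , 1#) ≡ z)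
  ·-basis x y z =
    solve 3 (coords¹ λ u → u :· (:1 , :0 , :0) := proj₁ u) refl x y z ,
    solve 3 (coords¹ λ u → u :· (:0 , :1 , :0) := proj₁ (proj₂ u)) refl x y z ,
    solve 3 (coords¹ λ u → u :· (:0 , :0 , :1) := proj₂ (proj₂ u)) refl x y z

  -- Vector identities are checked against an arbitrary third vector, with a single solver call.
  ·-ext : ∀ {u v} → (∀ w → u · w ≡ v · w) → u ≡ v
  ·-ext {u₁ , u₂ , u₃} {v₁ , v₂ , v₃} u·≡v· = ≡³
    (via (proj₁ (·-basis u₁ u₂ u₃)) (proj₁ (·-basis v₁ v₂ v₃)))
    (via (proj₁ (proj₂ (·-basis u₁ u₂ u₃))) (proj₁ (proj₂ (·-basis v₁ v₂ v₃))))
    (via (proj₂ (proj₂ (·-basis u₁ u₂ u₃))) (proj₂ (proj₂ (·-basis v₁ v₂ v₃))))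
    where
    via : ∀ {w x y} → (u₁ , u₂ , u₃) · w ≡ x → (v₁ , v₂ , v₃) · w ≡ y → x ≡ y
    via {w} u·w≡x v·w≡y = trans (sym u·w≡x) (trans (u·≡v· w) v·w≡y)

  ·-comm : ∀ u v → u · v ≡ v · u
  ·-comm (u₁ , u₂ , u₃) (v₁ , v₂ , v₃) =
    solve 6 (coords² λ u v → u :· v := v :· u) refl u₁ u₂ u₃ v₁ v₂ v₃

  ⨯-⊥ˡ : ∀ u v → (u ⨯ v) · u ≡ 0#
  ⨯-⊥ˡ (u₁ , u₂ , u₃) (v₁ , v₂ , v₃) =
    solve 6 (coords² λ u v → u :⨯ v :· u := :0) refl u₁ u₂ u₃ v₁ v₂ v₃

  ⨯-⊥ʳ : ∀ u v → (u ⨯ v) · v ≡ 0#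
  ⨯-⊥ʳ (u₁ , u₂ , u₃) (v₁ , v₂ , v₃) =
    solve 6 (coords² λ u v → u :⨯ v :· v := :0) refl u₁ u₂ u₃ v₁ v₂ v₃

  ⋆-·ˡ : ∀ k u v → (k ⋆ u) · v ≡ k * (u · v)
  ⋆-·ˡ k (u₁ , u₂ , u₃) (v₁ , v₂ , v₃) =
    solve 7 (λ k → coords² λ u v → k :⋆ u :· v := k :* (u :· v)) refl k u₁ u₂ u₃ v₁ v₂ v₃

  ·-⋆ʳ : ∀ k u v → u · (k ⋆ v) ≡ k * (u · v)
  ·-⋆ʳ k (u₁ , u₂ , u₃) (v₁ , v₂ , v₃) =
    solve 7 (λ k → coords² λ u v → u :· k :⋆ v := k :* (u :· v)) refl k u₁ u₂ u₃ v₁ v₂ v₃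

  ·-⊕⋆ : ∀ t x u v → x · (u ⊕ t ⋆ v) ≡ x · u + t * (x · v)
  ·-⊕⋆ t (x₁ , x₂ , x₃) (u₁ , u₂ , u₃) (v₁ , v₂ , v₃) =
    solve 10 (λ t → coords³ λ x u v → x :· (u :⊕ t :⋆ v) := (x :· u) :+ t :* (x :· v))
      refl t x₁ x₂ x₃ u₁ u₂ u₃ v₁ v₂ v₃

  det-cyclic : ∀ u v w → det u v w ≡ det v w u
  det-cyclic (u₁ , u₂ , u₃) (v₁ , v₂ , v₃) (w₁ , w₂ , w₃) =
    solve 9 (coords³ λ u v w → :det u v w := :det v w u) refl u₁ u₂ u₃ v₁ v₂ v₃ w₁ w₂ w₃

  det-swap : ∀ u v w → det u v w ≡ - det w v u
  det-swap (u₁ , u₂ , u₃) (v₁ , v₂ , v₃) (w₁ , w₂ , w₃) =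
    solve 9 (coords³ λ u v w → :det u v w := :- :det w v u) refl u₁ u₂ u₃ v₁ v₂ v₃ w₁ w₂ w₃

  det-⋆ : ∀ a b c u v w → det (a ⋆ u) (b ⋆ v) (c ⋆ w) ≡ a * b * c * det u v w
  det-⋆ a b c (u₁ , u₂ , u₃) (v₁ , v₂ , v₃) (w₁ , w₂ , w₃) =
    solve 12 (λ a b c → coords³ λ u v w → :det (a :⋆ u) (b :⋆ v) (c :⋆ w) := a :* b :* c :* :det u v w)
      refl a b c u₁ u₂ u₃ v₁ v₂ v₃ w₁ w₂ w₃

  lagrange : ∀ u v w → u ⨯ (v ⨯ w) ≡ (u · w) ⋆ v ⊖ (u · v) ⋆ w
  lagrange (u₁ , u₂ , u₃) (v₁ , v₂ , v₃) (w₁ , w₂ , w₃) = ·-ext λ (x₁ , x₂ , x₃) →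
    solve 12 (coords⁴ λ u v w x → u :⨯ (v :⨯ w) :· x := ((u :· w) :⋆ v :⊖ (u :· v) :⋆ w) :· x)
      refl u₁ u₂ u₃ v₁ v₂ v₃ w₁ w₂ w₃ x₁ x₂ x₃

  ⨯-self : ∀ u → u ⨯ u ≡ 0⃗
  ⨯-self (u₁ , u₂ , u₃) = ·-ext λ (x₁ , x₂ , x₃) →
    solve 6 (coords² λ u x → u :⨯ u :· x := (:0 , :0 , :0) :· x) refl u₁ u₂ u₃ x₁ x₂ x₃

  0⃗-⨯ : ∀ u → 0⃗ ⨯ u ≡ 0⃗
  0⃗-⨯ (u₁ , u₂ , u₃) = ·-ext λ (x₁ , x₂ , x₃) →
    solve 6 (coords² λ u x → (:0 , :0 , :0) :⨯ u :· x := (:0 , :0 , :0) :· x) refl u₁ u₂ u₃ x₁ x₂ x₃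

  0⋆ : ∀ u → 0# ⋆ u ≡ 0⃗
  0⋆ (u₁ , u₂ , u₃) = ·-ext λ (x₁ , x₂ , x₃) →
    solve 6 (coords² λ u x → :0 :⋆ u :· x := (:0 , :0 , :0) :· x) refl u₁ u₂ u₃ x₁ x₂ x₃

  ⋆-0⃗ : ∀ k → k ⋆ 0⃗ ≡ 0⃗
  ⋆-0⃗ k = ·-ext λ (x₁ , x₂ , x₃) →
    solve 4 (λ k → coords¹ λ x → k :⋆ (:0 , :0 , :0) :· x := (:0 , :0 , :0) :· x) refl k x₁ x₂ x₃

  0⋆⊖0⋆ : ∀ u v → 0# ⋆ u ⊖ 0# ⋆ v ≡ 0⃗
  0⋆⊖0⋆ (u₁ , u₂ , u₃) (v₁ , v₂ , v₃) = ·-ext λ (x₁ , x₂ , x₃) →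
    solve 9 (coords³ λ u v x → (:0 :⋆ u :⊖ :0 :⋆ v) :· x := (:0 , :0 , :0) :· x)
      refl u₁ u₂ u₃ v₁ v₂ v₃ x₁ x₂ x₃

  1⋆ : ∀ u → 1# ⋆ u ≡ u
  1⋆ (u₁ , u₂ , u₃) = ·-ext λ (x₁ , x₂ , x₃) →
    solve 6 (coords² λ u x → :1 :⋆ u :· x := u :· x) refl u₁ u₂ u₃ x₁ x₂ x₃

  ⋆-⋆ : ∀ a b u → a ⋆ b ⋆ u ≡ (a * b) ⋆ u
  ⋆-⋆ a b (u₁ , u₂ , u₃) = ·-ext λ (x₁ , x₂ , x₃) →
    solve 8 (λ a b → coords² λ u x → a :⋆ b :⋆ u :· x := (a :* b) :⋆ u :· x) refl a b u₁ u₂ u₃ x₁ x₂ x₃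

  ⋆-⨯ˡ : ∀ k u v → (k ⋆ u) ⨯ v ≡ k ⋆ (u ⨯ v)
  ⋆-⨯ˡ k (u₁ , u₂ , u₃) (v₁ , v₂ , v₃) = ·-ext λ (x₁ , x₂ , x₃) →
    solve 10 (λ k → coords³ λ u v x → (k :⋆ u) :⨯ v :· x := k :⋆ (u :⨯ v) :· x)
      refl k u₁ u₂ u₃ v₁ v₂ v₃ x₁ x₂ x₃

  ⋆-⨯ʳ : ∀ k u v → u ⨯ (k ⋆ v) ≡ k ⋆ (u ⨯ v)
  ⋆-⨯ʳ k (u₁ , u₂ , u₃) (v₁ , v₂ , v₃) = ·-ext λ (x₁ , x₂ , x₃) →
    solve 10 (λ k → coords³ λ u v x → u :⨯ (k :⋆ v) :· x := k :⋆ (u :⨯ v) :· x)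
      refl k u₁ u₂ u₃ v₁ v₂ v₃ x₁ x₂ x₃

  ⋆-⨯-⋆-self : ∀ a b u → (a ⋆ u) ⨯ (b ⋆ u) ≡ 0⃗
  ⋆-⨯-⋆-self a b (u₁ , u₂ , u₃) = ·-ext λ (x₁ , x₂ , x₃) →
    solve 8 (λ a b → coords² λ u x → (a :⋆ u) :⨯ (b :⋆ u) :· x := (:0 , :0 , :0) :· x)
      refl a b u₁ u₂ u₃ x₁ x₂ x₃

  ⊕⋆-⨯ : ∀ t u v → (u ⊕ t ⋆ v) ⨯ v ≡ u ⨯ v
  ⊕⋆-⨯ t (u₁ , u₂ , u₃) (v₁ , v₂ , v₃) = ·-ext λ (x₁ , x₂ , x₃) →
    solve 10 (λ t → coords³ λ u v x → (u :⊕ t :⋆ v) :⨯ v :· x := u :⨯ v :· x)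
      refl t u₁ u₂ u₃ v₁ v₂ v₃ x₁ x₂ x₃

  ⊕⋆-⨯-⊕⋆ : ∀ s t u v → (u ⊕ s ⋆ v) ⨯ (u ⊕ t ⋆ v) ≡ (t + - s) ⋆ (u ⨯ v)
  ⊕⋆-⨯-⊕⋆ s t (u₁ , u₂ , u₃) (v₁ , v₂ , v₃) = ·-ext λ (x₁ , x₂ , x₃) →
    solve 11 (λ s t → coords³ λ u v x → (u :⊕ s :⋆ v) :⨯ (u :⊕ t :⋆ v) :· x := (t :+ :- s) :⋆ (u :⨯ v) :· x)
      refl s t u₁ u₂ u₃ v₁ v₂ v₃ x₁ x₂ x₃

  ⨯-⊕⋆ : ∀ t x u v → x ⨯ (u ⊕ t ⋆ v) ≡ x ⨯ u ⊕ t ⋆ (x ⨯ v)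
  ⨯-⊕⋆ t (x₁ , x₂ , x₃) (u₁ , u₂ , u₃) (v₁ , v₂ , v₃) = ·-ext λ (y₁ , y₂ , y₃) →
    solve 13 (λ t → coords⁴ λ x u v y → x :⨯ (u :⊕ t :⋆ v) :· y := (x :⨯ u :⊕ t :⋆ (x :⨯ v)) :· y)
      refl t x₁ x₂ x₃ u₁ u₂ u₃ v₁ v₂ v₃ y₁ y₂ y₃

  ⋆-⊕-⋆⋆ : ∀ a b t u → a ⋆ u ⊕ t ⋆ b ⋆ u ≡ (a + t * b) ⋆ u
  ⋆-⊕-⋆⋆ a b t (u₁ , u₂ , u₃) = ·-ext λ (x₁ , x₂ , x₃) →
    solve 9 (λ a b t → coords² λ u x → (a :⋆ u :⊕ t :⋆ b :⋆ u) :· x := (a :+ t :* b) :⋆ u :· x)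
      refl a b t u₁ u₂ u₃ x₁ x₂ x₃

  fano-identity : ∀ x y z a b c →
    det (x ⋆ b ⊖ y ⋆ c) (z ⋆ a ⊖ (- y) ⋆ c) ((- z) ⋆ a ⊖ (- x) ⋆ b)
      ≡ - (x * y * z * det a b c + x * y * z * det a b c)
  fano-identity x y z (a₁ , a₂ , a₃) (b₁ , b₂ , b₃) (c₁ , c₂ , c₃) =
    solve 12 (λ x y z → coords³ λ a b c →
      :det (x :⋆ b :⊖ y :⋆ c) (z :⋆ a :⊖ (:- y) :⋆ c) ((:- z) :⋆ a :⊖ (:- x) :⋆ b)
        := :- (x :* y :* z :* :det a b c :+ x :* y :* z :* :det a b c))
      refl x y z a₁ a₂ a₃ b₁ b₂ b₃ c₁ c₂ c₃

  ⋆-⊥ : ∀ k {u v} → u · v ≡ 0# → (k ⋆ u) · v ≡ 0#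
  ⋆-⊥ k {u} {v} u·v≡0 = begin
    (k ⋆ u) · v  ≡⟨ ⋆-·ˡ k u v ⟩
    k * (u · v)  ≡⟨ cong (k *_) u·v≡0 ⟩
    k * 0#       ≡⟨ zeroʳ k ⟩
    0#           ∎

  ⋆≡0⃗ : ∀ {k v} → k ⋆ v ≡ 0⃗ → v ≢ 0⃗ → k ≡ 0#
  ⋆≡0⃗ {k} {v₁ , v₂ , v₃} kv≡0⃗ v≢0⃗ with k ≟ 0# | ≡³⁻¹ kv≡0⃗
  ... | yes k≡0 | _               = k≡0
  ... | no k≢0  | kv₁≡0 , kv₂≡0 , kv₃≡0 = ⊥-elim (v≢0⃗ (≡³
    (x*y≡0⇒y≡0 k≢0 kv₁≡0) (x*y≡0⇒y≡0 k≢0 kv₂≡0) (x*y≡0⇒y≡0 k≢0 kv₃≡0)))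

  private
    rotate : Vec3 → Vec3
    rotate (x , y , z) = y , z , x

    multiple-of-v₁≢0 : ∀ {u₁ u₂ u₃ v₁ v₂ v₃} (v₁≢0 : v₁ ≢ 0#) →
      (u₁ , u₂ , u₃) ⨯ (v₁ , v₂ , v₃) ≡ 0⃗ → (u₁ , u₂ , u₃) ≡ (u₁ * inv v₁ v₁≢0) ⋆ (v₁ , v₂ , v₃)
    multiple-of-v₁≢0 v₁≢0 u⨯v≡0⃗ with ≡³⁻¹ u⨯v≡0⃗
    ... | _ , c₂≡0 , c₃≡0 = ≡³
      (w*c≡v*d⇒w≡v/c*d v₁≢0 refl)
      (w*c≡v*d⇒w≡v/c*d v₁≢0 (sym (x-y≡0⇒x≡y c₃≡0)))
      (w*c≡v*d⇒w≡v/c*d v₁≢0 (x-y≡0⇒x≡y c₂≡0))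

  -- rotate commutes definitionally with ⨯ and ⋆, reducing the cases v₂ ≢ 0 and v₃ ≢ 0 to v₁ ≢ 0.
  ⨯≡0⃗⇒multiple : ∀ {u v} → u ⨯ v ≡ 0⃗ → v ≢ 0⃗ → ∃ λ k → u ≡ k ⋆ v
  ⨯≡0⃗⇒multiple {u₁ , u₂ , u₃} {v₁ , v₂ , v₃} u⨯v≡0⃗ v≢0⃗ with v₁ ≟ 0# | v₂ ≟ 0# | v₃ ≟ 0#
  ... | no v₁≢0 | _       | _       = _ , multiple-of-v₁≢0 v₁≢0 u⨯v≡0⃗
  ... | yes _   | no v₂≢0 | _       =
    _ , cong (rotate ∘ rotate) (multiple-of-v₁≢0 v₂≢0 (cong rotate u⨯v≡0⃗))
  ... | yes _   | yes _   | no v₃≢0 =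
    _ , cong rotate (multiple-of-v₁≢0 v₃≢0 (cong (rotate ∘ rotate) u⨯v≡0⃗))
  ... | yes v₁≡0 | yes v₂≡0 | yes v₃≡0 = ⊥-elim (v≢0⃗ (≡³ v₁≡0 v₂≡0 v₃≡0))

module Plane {q} (F : FiniteField q) where
  open Vectors F public
  open PG2 F public hiding (Vec3)
  open ≡-Reasoning

  vec : Point → Vec3
  vec = proj₁

  -- Unlike P on m, whose type computes to an equation of coordinates, P ∈ m
  -- determines P and m, so they can be left implicit.
  infix 4 _∈_
  record _∈_ (P : Point) (m : Line) : Set where
    constructor incident
    field incidence : P on m
  open _∈_ public

  uip : UIP Carrier
  uip = Decidable⇒UIP.≡-irrelevant _≟_

  ∈-dual : ∀ {P m} → P ∈ m → m ∈ P
  ∈-dual {P} {m} (incident P∈m) = incident (trans (·-comm (vec P) (vec m)) P∈m)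

  normalised-≢0⃗ : ∀ {v} → Normalised v → v ≢ 0⃗
  normalised-≢0⃗ (inj₁ x≡1)                 refl = 0≢1 x≡1
  normalised-≢0⃗ (inj₂ (inj₁ (_ , y≡1)))     refl = 0≢1 y≡1
  normalised-≢0⃗ (inj₂ (inj₂ (_ , _ , z≡1))) refl = 0≢1 z≡1

  normalised-irrelevant : ∀ {v} → Irrelevant (Normalised v)
  normalised-irrelevant (inj₁ p) (inj₁ p′) = cong inj₁ (uip p p′)
  normalised-irrelevant (inj₂ (inj₁ (p , q))) (inj₂ (inj₁ (p′ , q′))) =
    cong (inj₂ ∘ inj₁) (cong₂ _,_ (uip p p′) (uip q q′))
  normalised-irrelevant (inj₂ (inj₂ (p , q , r))) (inj₂ (inj₂ (p′ , q′ , r′))) =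
    cong (inj₂ ∘ inj₂) (cong₂ _,_ (uip p p′) (cong₂ _,_ (uip q q′) (uip r r′)))
  normalised-irrelevant (inj₁ x≡1) (inj₂ (inj₁ (x≡0 , _)))      = ⊥-elim (0≢1 (trans (sym x≡0) x≡1))
  normalised-irrelevant (inj₁ x≡1) (inj₂ (inj₂ (x≡0 , _)))      = ⊥-elim (0≢1 (trans (sym x≡0) x≡1))
  normalised-irrelevant (inj₂ (inj₁ (x≡0 , _))) (inj₁ x≡1)      = ⊥-elim (0≢1 (trans (sym x≡0) x≡1))
  normalised-irrelevant (inj₂ (inj₂ (x≡0 , _))) (inj₁ x≡1)      = ⊥-elim (0≢1 (trans (sym x≡0) x≡1))
  normalised-irrelevant (inj₂ (inj₁ (_ , y≡1))) (inj₂ (inj₂ (_ , y≡0 , _))) = ⊥-elim (0≢1 (trans (sym y≡0) y≡1))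
  normalised-irrelevant (inj₂ (inj₂ (_ , y≡0 , _))) (inj₂ (inj₁ (_ , y≡1))) = ⊥-elim (0≢1 (trans (sym y≡0) y≡1))

  vec-injective : ∀ {P Q} → vec P ≡ vec Q → P ≡ Q
  vec-injective {P} {Q} eq = Σ-≡,≡→≡ (eq , normalised-irrelevant _ (proj₂ Q))

  infix 4 _≟ₚ_
  _≟ₚ_ : DecidableEquality Point
  _≟ₚ_ = ≡-dec (≡-dec _≟_ (≡-dec _≟_ _≟_)) (λ p q → yes (normalised-irrelevant p q))

  normalised-unique : ∀ {v w k} → Normalised v → Normalised w → v ≡ k ⋆ w → v ≡ w
  normalised-unique {v} {w} {k} nv nw v≡kw = begin
    v       ≡⟨ v≡kw ⟩
    k ⋆ w   ≡⟨ cong (_⋆ w) (k≡1 nv nw (≡³⁻¹ v≡kw)) ⟩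
    1# ⋆ w  ≡⟨ 1⋆ w ⟩
    w       ∎
    where
    leading : ∀ {x y} → x ≡ 1# → y ≡ 1# → x ≡ k * y → k ≡ 1#
    leading x≡1 y≡1 x≡ky = trans (sym (*-identityʳ k)) (trans (cong (k *_) (sym y≡1)) (trans (sym x≡ky) x≡1))
    early : ∀ {x y} → x ≡ 1# → y ≡ 0# → x ≡ k * y → k ≡ 1#
    early x≡1 y≡0 x≡ky = ⊥-elim (0≢1 (trans (sym (trans x≡ky (trans (cong (k *_) y≡0) (zeroʳ k)))) x≡1))
    late : ∀ {x y} → x ≡ 0# → y ≡ 1# → x ≡ k * y → k ≡ 1#
    late x≡0 y≡1 x≡ky = ⊥-elim (normalised-≢0⃗ nv (begin
      v       ≡⟨ v≡kw ⟩
      k ⋆ w   ≡⟨ cong (_⋆ w) (leading-zero) ⟩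
      0# ⋆ w  ≡⟨ 0⋆ w ⟩
      0⃗       ∎))
      where
      leading-zero : k ≡ 0#
      leading-zero = trans (sym (*-identityʳ k)) (trans (cong (k *_) (sym y≡1)) (trans (sym x≡ky) x≡0))
    k≡1 : Normalised v → Normalised w →
          proj₁ v ≡ k * proj₁ w × proj₁ (proj₂ v) ≡ k * proj₁ (proj₂ w)
                                × proj₂ (proj₂ v) ≡ k * proj₂ (proj₂ w) → k ≡ 1#
    k≡1 (inj₁ a)                  (inj₁ b)                  (e , _)     = leading a b e
    k≡1 (inj₁ a)                  (inj₂ (inj₁ (b , _)))      (e , _)     = early a b e
    k≡1 (inj₁ a)                  (inj₂ (inj₂ (b , _)))      (e , _)     = early a b e
    k≡1 (inj₂ (inj₁ (a , _)))      (inj₁ b)                  (e , _)     = late a b e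
    k≡1 (inj₂ (inj₁ (_ , a)))      (inj₂ (inj₁ (_ , b)))      (_ , e , _) = leading a b e
    k≡1 (inj₂ (inj₁ (_ , a)))      (inj₂ (inj₂ (_ , b , _)))  (_ , e , _) = early a b e
    k≡1 (inj₂ (inj₂ (a , _)))      (inj₁ b)                  (e , _)     = late a b e
    k≡1 (inj₂ (inj₂ (_ , a , _)))  (inj₂ (inj₁ (_ , b)))      (_ , e , _) = late a b e
    k≡1 (inj₂ (inj₂ (_ , _ , a)))  (inj₂ (inj₂ (_ , _ , b)))  (_ , _ , e) = leading a b e

  ⨯≡0⃗⇒≡ : ∀ {P Q} → vec P ⨯ vec Q ≡ 0⃗ → P ≡ Q
  ⨯≡0⃗⇒≡ {P} {Q} P⨯Q≡0⃗ with ⨯≡0⃗⇒multiple P⨯Q≡0⃗ (normalised-≢0⃗ (proj₂ Q))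
  ... | k , P≡kQ = vec-injective (normalised-unique (proj₂ P) (proj₂ Q) P≡kQ)

  ⨯-≢0⃗ : ∀ {P Q} → P ≢ Q → vec P ⨯ vec Q ≢ 0⃗
  ⨯-≢0⃗ P≢Q = P≢Q ∘ ⨯≡0⃗⇒≡

  private
    scaled-zero : ∀ {k x} → x ≡ 0# → k * x ≡ 0#
    scaled-zero {k} refl = zeroʳ k

  normalise : ∀ v → v ≢ 0⃗ → ∃[ P ] ∃[ μ ] (μ ≢ 0# × vec P ≡ μ ⋆ v)
  normalise (v₁ , v₂ , v₃) v≢0⃗ with v₁ ≟ 0# | v₂ ≟ 0# | v₃ ≟ 0#
  ... | no v₁≢0 | _ | _ =
    (_ , inj₁ (*-inverseˡ v₁≢0)) , _ , inv-≢0 v₁≢0 , refl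
  ... | yes v₁≡0 | no v₂≢0 | _ =
    (_ , inj₂ (inj₁ (scaled-zero v₁≡0 , *-inverseˡ v₂≢0))) , _ , inv-≢0 v₂≢0 , refl
  ... | yes v₁≡0 | yes v₂≡0 | no v₃≢0 =
    (_ , inj₂ (inj₂ (scaled-zero v₁≡0 , scaled-zero v₂≡0 , *-inverseˡ v₃≢0))) , _ , inv-≢0 v₃≢0 , refl
  ... | yes v₁≡0 | yes v₂≡0 | yes v₃≡0 = ⊥-elim (v≢0⃗ (≡³ v₁≡0 v₂≡0 v₃≡0))

  ⊥⊥⇒multiple : ∀ {u v w} → u · v ≡ 0# → u · w ≡ 0# → v ⨯ w ≢ 0⃗ → ∃ λ k → u ≡ k ⋆ (v ⨯ w)
  ⊥⊥⇒multiple {u} {v} {w} u·v≡0 u·w≡0 = ⨯≡0⃗⇒multiple (begin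
    u ⨯ (v ⨯ w)                ≡⟨ lagrange u v w ⟩
    (u · w) ⋆ v ⊖ (u · v) ⋆ w  ≡⟨ cong₂ (λ x y → x ⋆ v ⊖ y ⋆ w) u·w≡0 u·v≡0 ⟩
    0# ⋆ v ⊖ 0# ⋆ w            ≡⟨ 0⋆⊖0⋆ v w ⟩
    0⃗                          ∎)

  line-vector : ∀ {P Q m} → P ≢ Q → P ∈ m → Q ∈ m → ∃ λ k → vec m ≡ k ⋆ (vec P ⨯ vec Q)
  line-vector P≢Q (incident P∈m) (incident Q∈m) = ⊥⊥⇒multiple P∈m Q∈m (⨯-≢0⃗ P≢Q)

  join : ∀ {P Q} → P ≢ Q → Line
  join P≢Q = proj₁ (normalise _ (⨯-≢0⃗ P≢Q))

  join-vector : ∀ {P Q} (P≢Q : P ≢ Q) → ∃ λ μ → vec (join P≢Q) ≡ μ ⋆ (vec P ⨯ vec Q)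
  join-vector P≢Q = let _ , μ , _ , eq = normalise _ (⨯-≢0⃗ P≢Q) in μ , eq

  ∈-joinˡ : ∀ {P Q} (P≢Q : P ≢ Q) → P ∈ join P≢Q
  ∈-joinˡ {P} {Q} P≢Q = incident (subst (λ m → m · vec P ≡ 0#) (sym (proj₂ (join-vector P≢Q)))
    (⋆-⊥ (proj₁ (join-vector P≢Q)) (⨯-⊥ˡ (vec P) (vec Q))))

  ∈-joinʳ : ∀ {P Q} (P≢Q : P ≢ Q) → Q ∈ join P≢Q
  ∈-joinʳ {P} {Q} P≢Q = incident (subst (λ m → m · vec Q ≡ 0#) (sym (proj₂ (join-vector P≢Q)))
    (⋆-⊥ (proj₁ (join-vector P≢Q)) (⨯-⊥ʳ (vec P) (vec Q))))

  join-unique : ∀ {P Q m m′} → P ≢ Q → P ∈ m → Q ∈ m → P ∈ m′ → Q ∈ m′ → m ≡ m′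
  join-unique {P} {Q} {m} {m′} P≢Q P∈m Q∈m P∈m′ Q∈m′ = ⨯≡0⃗⇒≡ (begin
    vec m ⨯ vec m′                                  ≡⟨ cong₂ _⨯_ (proj₂ m-vector) (proj₂ m′-vector) ⟩
    (k ⋆ (vec P ⨯ vec Q)) ⨯ (k′ ⋆ (vec P ⨯ vec Q))  ≡⟨ ⋆-⨯-⋆-self k k′ (vec P ⨯ vec Q) ⟩
    0⃗                                               ∎)
    where
    m-vector : ∃ λ k → vec m ≡ k ⋆ (vec P ⨯ vec Q)
    m-vector = line-vector P≢Q P∈m Q∈m
    m′-vector : ∃ λ k → vec m′ ≡ k ⋆ (vec P ⨯ vec Q)
    m′-vector = line-vector P≢Q P∈m′ Q∈m′
    k k′ : Carrier
    k = proj₁ m-vector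
    k′ = proj₁ m′-vector

  meet : ∀ {m m′} → m ≢ m′ → Point
  meet = join

  ∈-meetˡ : ∀ {m m′} (m≢m′ : m ≢ m′) → meet m≢m′ ∈ m
  ∈-meetˡ m≢m′ = ∈-dual (∈-joinˡ m≢m′)

  ∈-meetʳ : ∀ {m m′} (m≢m′ : m ≢ m′) → meet m≢m′ ∈ m′
  ∈-meetʳ m≢m′ = ∈-dual (∈-joinʳ m≢m′)

  meet-unique : ∀ {P Q m m′} → m ≢ m′ → P ∈ m → P ∈ m′ → Q ∈ m → Q ∈ m′ → P ≡ Q
  meet-unique m≢m′ P∈m P∈m′ Q∈m Q∈m′ =
    join-unique m≢m′ (∈-dual P∈m) (∈-dual P∈m′) (∈-dual Q∈m) (∈-dual Q∈m′)

  det≡0⇒∈ : ∀ {P Q R m} → P ≢ Q → P ∈ m → Q ∈ m → det (vec P) (vec Q) (vec R) ≡ 0# → R ∈ m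
  det≡0⇒∈ {R = R} P≢Q P∈m Q∈m det≡0 =
    let k , m≡k[P⨯Q] = line-vector P≢Q P∈m Q∈m
    in incident (subst (λ m → m · vec R ≡ 0#) (sym m≡k[P⨯Q]) (⋆-⊥ k det≡0))

  record IsMeet (X P Q R S : Point) : Set where
    field
      {m m′} : Line
      P≢Q : P ≢ Q
      R≢S : R ≢ S
      m≢m′ : m ≢ m′
      P∈m : P ∈ m
      Q∈m : Q ∈ m
      R∈m′ : R ∈ m′
      S∈m′ : S ∈ m′
      X∈m : X ∈ m
      X∈m′ : X ∈ m′

  meet-vector : ∀ {X P Q R S} → IsMeet X P Q R S →
    ∃ λ k → vec X ≡ k ⋆ ((vec P ⨯ vec Q) ⨯ (vec R ⨯ vec S))
  meet-vector {X} {P} {Q} {R} {S} X-meet = κ * (μ * ν) , (begin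
    vec X                    ≡⟨ X≡κ[m⨯m′] ⟩
    κ ⋆ (vec m ⨯ vec m′)     ≡⟨ cong₂ (λ x y → κ ⋆ (x ⨯ y)) m≡μu m′≡νv ⟩
    κ ⋆ ((μ ⋆ u) ⨯ (ν ⋆ v))  ≡⟨ cong (κ ⋆_) (⋆-⨯ˡ μ u (ν ⋆ v)) ⟩
    κ ⋆ μ ⋆ (u ⨯ (ν ⋆ v))    ≡⟨ cong (λ x → κ ⋆ μ ⋆ x) (⋆-⨯ʳ ν u v) ⟩
    κ ⋆ μ ⋆ ν ⋆ (u ⨯ v)      ≡⟨ cong (κ ⋆_) (⋆-⋆ μ ν (u ⨯ v)) ⟩
    κ ⋆ (μ * ν) ⋆ (u ⨯ v)    ≡⟨ ⋆-⋆ κ (μ * ν) (u ⨯ v) ⟩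
    (κ * (μ * ν)) ⋆ (u ⨯ v)  ∎)
    where
    open IsMeet X-meet
    u v : Vec3
    u = vec P ⨯ vec Q
    v = vec R ⨯ vec S
    X-vector : ∃ λ κ → vec X ≡ κ ⋆ (vec m ⨯ vec m′)
    X-vector = ⊥⊥⇒multiple (incidence (∈-dual X∈m)) (incidence (∈-dual X∈m′)) (⨯-≢0⃗ m≢m′)
    m-vector : ∃ λ μ → vec m ≡ μ ⋆ u
    m-vector = line-vector P≢Q P∈m Q∈m
    m′-vector : ∃ λ ν → vec m′ ≡ ν ⋆ v
    m′-vector = line-vector R≢S R∈m′ S∈m′
    κ μ ν : Carrier
    κ = proj₁ X-vector
    μ = proj₁ m-vector
    ν = proj₁ m′-vector
    X≡κ[m⨯m′] : vec X ≡ κ ⋆ (vec m ⨯ vec m′)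
    X≡κ[m⨯m′] = proj₂ X-vector
    m≡μu : vec m ≡ μ ⋆ u
    m≡μu = proj₂ m-vector
    m′≡νv : vec m′ ≡ ν ⋆ v
    m′≡νv = proj₂ m′-vector

  diagonal-det : 1# + 1# ≡ 0# → ∀ a b c e →
    det ((a ⨯ e) ⨯ (b ⨯ c)) ((b ⨯ e) ⨯ (a ⨯ c)) ((c ⨯ e) ⨯ (a ⨯ b)) ≡ 0#
  diagonal-det 2≡0 a b c e = begin
    det ((a ⨯ e) ⨯ (b ⨯ c)) ((b ⨯ e) ⨯ (a ⨯ c)) ((c ⨯ e) ⨯ (a ⨯ b))
      ≡⟨ cong₃ det (lagrange (a ⨯ e) b c) (lagrange (b ⨯ e) a c) (lagrange (c ⨯ e) a b) ⟩
    det (x ⋆ b ⊖ y ⋆ c) (z ⋆ a ⊖ det b e a ⋆ c) (det c e b ⋆ a ⊖ det c e a ⋆ b)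
      ≡⟨ cong₃ (λ y′ z′ x′ → det (x ⋆ b ⊖ y ⋆ c) (z ⋆ a ⊖ y′ ⋆ c) (z′ ⋆ a ⊖ x′ ⋆ b))
           (det-swap b e a) (det-swap c e b) (det-swap c e a) ⟩
    det (x ⋆ b ⊖ y ⋆ c) (z ⋆ a ⊖ (- y) ⋆ c) ((- z) ⋆ a ⊖ (- x) ⋆ b)
      ≡⟨ fano-identity x y z a b c ⟩
    - (w + w)
      ≡⟨ cong -_ (x+x≡0 2≡0 w) ⟩
    - 0#
      ≡⟨ -0#≈0# ⟩
    0# ∎
    where
    x y z w : Carrier
    x = det a e c
    y = det a e b
    z = det b e c
    w = x * y * z * det a b c

  fano : 1# + 1# ≡ 0# → ∀ {A B C E X Y Z n} →
    IsMeet X A E B C → IsMeet Y B E A C → IsMeet Z C E A B → X ≢ Y → X ∈ n → Y ∈ n → Z ∈ n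
  fano 2≡0 {A} {B} {C} {E} {X} {Y} {Z} X-meet Y-meet Z-meet X≢Y X∈n Y∈n = det≡0⇒∈ X≢Y X∈n Y∈n (begin
    det (vec X) (vec Y) (vec Z)
      ≡⟨ cong₃ det (proj₂ X-vector) (proj₂ Y-vector) (proj₂ Z-vector) ⟩
    det (kX ⋆ (a ⨯ e) ⨯ (b ⨯ c)) (kY ⋆ (b ⨯ e) ⨯ (a ⨯ c)) (kZ ⋆ (c ⨯ e) ⨯ (a ⨯ b))
      ≡⟨ det-⋆ kX kY kZ _ _ _ ⟩
    kX * kY * kZ * det ((a ⨯ e) ⨯ (b ⨯ c)) ((b ⨯ e) ⨯ (a ⨯ c)) ((c ⨯ e) ⨯ (a ⨯ b))
      ≡⟨ cong (kX * kY * kZ *_) (diagonal-det 2≡0 a b c e) ⟩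
    kX * kY * kZ * 0#
      ≡⟨ zeroʳ _ ⟩
    0# ∎)
    where
    a b c e : Vec3
    a = vec A
    b = vec B
    c = vec C
    e = vec E
    X-vector : ∃ λ k → vec X ≡ k ⋆ ((a ⨯ e) ⨯ (b ⨯ c))
    X-vector = meet-vector X-meet
    Y-vector : ∃ λ k → vec Y ≡ k ⋆ ((b ⨯ e) ⨯ (a ⨯ c))
    Y-vector = meet-vector Y-meet
    Z-vector : ∃ λ k → vec Z ≡ k ⋆ ((c ⨯ e) ⨯ (a ⨯ b))
    Z-vector = meet-vector Z-meet
    kX kY kZ : Carrier
    kX = proj₁ X-vector
    kY = proj₁ Y-vector
    kZ = proj₁ Z-vector

  module LineParametrisation {P Q m} (P≢Q : P ≢ Q) (P∈m : P ∈ m) (Q∈m : Q ∈ m) where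
    private
      c : Vec3
      c = vec P ⨯ vec Q

    direction : Carrier → Vec3
    direction t = vec P ⊕ t ⋆ vec Q

    direction-≢0⃗ : ∀ t → direction t ≢ 0⃗
    direction-≢0⃗ t d≡0⃗ = ⨯-≢0⃗ P≢Q (begin
      c                    ≡⟨ ⊕⋆-⨯ t (vec P) (vec Q) ⟨
      direction t ⨯ vec Q  ≡⟨ cong (_⨯ vec Q) d≡0⃗ ⟩
      0⃗ ⨯ vec Q            ≡⟨ 0⃗-⨯ (vec Q) ⟩
      0⃗                    ∎)

    point : Carrier → Point
    point t = proj₁ (normalise (direction t) (direction-≢0⃗ t))

    scale : Carrier → Carrier
    scale t = proj₁ (proj₂ (normalise (direction t) (direction-≢0⃗ t)))

    scale-≢0 : ∀ t → scale t ≢ 0#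
    scale-≢0 t = proj₁ (proj₂ (proj₂ (normalise (direction t) (direction-≢0⃗ t))))

    vec-point : ∀ t → vec (point t) ≡ scale t ⋆ direction t
    vec-point t = proj₂ (proj₂ (proj₂ (normalise (direction t) (direction-≢0⃗ t))))

    point-∈ : ∀ t → point t ∈ m
    point-∈ t = incident (begin
      vec m · vec (point t)                            ≡⟨ cong (vec m ·_) (vec-point t) ⟩
      vec m · scale t ⋆ direction t                    ≡⟨ ·-⋆ʳ (scale t) (vec m) (direction t) ⟩
      scale t * (vec m · direction t)                  ≡⟨ cong (scale t *_) (·-⊕⋆ t (vec m) (vec P) (vec Q)) ⟩
      scale t * (vec m · vec P + t * (vec m · vec Q))
        ≡⟨ cong₂ (λ x y → scale t * (x + t * y)) (incidence P∈m) (incidence Q∈m) ⟩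
      scale t * (0# + t * 0#)                          ≡⟨ cong (λ x → scale t * (0# + x)) (zeroʳ t) ⟩
      scale t * (0# + 0#)                              ≡⟨ cong (scale t *_) (+-identityʳ 0#) ⟩
      scale t * 0#                                     ≡⟨ zeroʳ (scale t) ⟩
      0#                                               ∎)

    point-injective : Injective _≡_ _≡_ point
    point-injective {s} {t} point-s≡point-t = sym (x-y≡0⇒x≡y
      (x*y≡0⇒y≡0 (scale-≢0 t) (x*y≡0⇒y≡0 (scale-≢0 s) (⋆≡0⃗ (begin
        (scale s * (scale t * (t + - s))) ⋆ c              ≡⟨ ⋆-⋆ (scale s) _ c ⟨
        scale s ⋆ (scale t * (t + - s)) ⋆ c                ≡⟨ cong (scale s ⋆_) (⋆-⋆ (scale t) _ c) ⟨
        scale s ⋆ scale t ⋆ (t + - s) ⋆ c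
          ≡⟨ cong (λ x → scale s ⋆ scale t ⋆ x) (⊕⋆-⨯-⊕⋆ s t (vec P) (vec Q)) ⟨
        scale s ⋆ scale t ⋆ (direction s ⨯ direction t)
          ≡⟨ cong (scale s ⋆_) (⋆-⨯ʳ (scale t) (direction s) (direction t)) ⟨
        scale s ⋆ (direction s ⨯ (scale t ⋆ direction t))  ≡⟨ ⋆-⨯ˡ (scale s) (direction s) _ ⟨
        (scale s ⋆ direction s) ⨯ (scale t ⋆ direction t)  ≡⟨ cong₂ _⨯_ (vec-point s) (vec-point t) ⟨
        vec (point s) ⨯ vec (point t)                      ≡⟨ cong (λ X → vec X ⨯ vec (point t)) point-s≡point-t ⟩
        vec (point t) ⨯ vec (point t)                      ≡⟨ ⨯-self (vec (point t)) ⟩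
        0⃗                                                  ∎) (⨯-≢0⃗ P≢Q)))))

    point-≢Q : ∀ t → point t ≢ Q
    point-≢Q t point-t≡Q = scale-≢0 t (⋆≡0⃗ (begin
      scale t ⋆ c                      ≡⟨ cong (scale t ⋆_) (⊕⋆-⨯ t (vec P) (vec Q)) ⟨
      scale t ⋆ (direction t ⨯ vec Q)  ≡⟨ ⋆-⨯ˡ (scale t) (direction t) (vec Q) ⟨
      (scale t ⋆ direction t) ⨯ vec Q  ≡⟨ cong (_⨯ vec Q) (vec-point t) ⟨
      vec (point t) ⨯ vec Q            ≡⟨ cong (λ X → vec X ⨯ vec Q) point-t≡Q ⟩
      vec Q ⨯ vec Q                    ≡⟨ ⨯-self (vec Q) ⟩
      0⃗                                ∎) (⨯-≢0⃗ P≢Q))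

    point-surjective : ∀ {X} → X ∈ m → X ≢ Q → ∃ λ t → X ≡ point t
    point-surjective {X} X∈m X≢Q = t , ⨯≡0⃗⇒≡ (begin
      vec X ⨯ vec (point t)            ≡⟨ cong (vec X ⨯_) (vec-point t) ⟩
      vec X ⨯ (scale t ⋆ direction t)  ≡⟨ ⋆-⨯ʳ (scale t) (vec X) (direction t) ⟩
      scale t ⋆ (vec X ⨯ direction t)  ≡⟨ cong (scale t ⋆_) (⨯-⊕⋆ t (vec X) (vec P) (vec Q)) ⟩
      scale t ⋆ (vec X ⨯ vec P ⊕ t ⋆ (vec X ⨯ vec Q))
        ≡⟨ cong₂ (λ x y → scale t ⋆ (x ⊕ t ⋆ y)) (proj₂ X⨯P-vector) (proj₂ X⨯Q-vector) ⟩
      scale t ⋆ (γ ⋆ c ⊕ t ⋆ α ⋆ c)  ≡⟨ cong (scale t ⋆_) (⋆-⊕-⋆⋆ γ α t c) ⟩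
      scale t ⋆ (γ + t * α) ⋆ c      ≡⟨ cong (λ x → scale t ⋆ x ⋆ c) (x-x/y*y≡0 γ α≢0) ⟩
      scale t ⋆ 0# ⋆ c               ≡⟨ cong (scale t ⋆_) (0⋆ c) ⟩
      scale t ⋆ 0⃗                    ≡⟨ ⋆-0⃗ (scale t) ⟩
      0⃗                              ∎)
      where
      m-vector : ∃ λ k → vec m ≡ k ⋆ c
      m-vector = line-vector P≢Q P∈m Q∈m
      k≢0 : proj₁ m-vector ≢ 0#
      k≢0 k≡0 = normalised-≢0⃗ (proj₂ m)
        (trans (proj₂ m-vector) (trans (cong (_⋆ c) k≡0) (0⋆ c)))
      c⊥X : c · vec X ≡ 0#
      c⊥X = x*y≡0⇒y≡0 k≢0 (begin
        proj₁ m-vector * (c · vec X)  ≡⟨ ⋆-·ˡ (proj₁ m-vector) c (vec X) ⟨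
        (proj₁ m-vector ⋆ c) · vec X  ≡⟨ cong (_· vec X) (proj₂ m-vector) ⟨
        vec m · vec X                 ≡⟨ incidence X∈m ⟩
        0#                            ∎)
      X⨯P-vector : ∃ λ γ → vec X ⨯ vec P ≡ γ ⋆ c
      X⨯P-vector = ⊥⊥⇒multiple (⨯-⊥ʳ (vec X) (vec P))
        (trans (det-cyclic (vec X) (vec P) (vec Q)) c⊥X) (⨯-≢0⃗ P≢Q)
      X⨯Q-vector : ∃ λ α → vec X ⨯ vec Q ≡ α ⋆ c
      X⨯Q-vector = ⊥⊥⇒multiple
        (trans (det-swap (vec X) (vec Q) (vec P)) (trans (cong -_ c⊥X) -0#≈0#)) (⨯-⊥ʳ (vec X) (vec Q)) (⨯-≢0⃗ P≢Q)
      γ α : Carrier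
      γ = proj₁ X⨯P-vector
      α = proj₁ X⨯Q-vector
      α≢0 : α ≢ 0#
      α≢0 α≡0 = ⨯-≢0⃗ X≢Q (trans (proj₂ X⨯Q-vector) (trans (cong (_⋆ c) α≡0) (0⋆ c)))
      t : Carrier
      t = - (γ * inv α α≢0)

    points : Fin (suc q) → Point
    points = Q ∷ point ∘ from

    points-injective : Injective _≡_ _≡_ points
    points-injective = ∷-injective {f = point ∘ from}
      (λ {i} {j} eq → from-injective (point-injective {from i} {from j} eq)) (λ i → point-≢Q (from i))

    points-∈ : ∀ i → points i ∈ m
    points-∈ zero    = Q∈m
    points-∈ (suc i) = point-∈ (from i)

    points-cover : ∀ {X} → X ∈ m → ∃ λ i → X ≡ points i
    points-cover {X} X∈m = cases (X ≟ₚ Q)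
      where
      cases : Dec (X ≡ Q) → ∃ λ i → X ≡ points i
      cases (yes X≡Q) = zero , X≡Q
      cases (no X≢Q)  = suc (to t) , trans X≡point-t (cong point (sym (strictlyInverseʳ t)))
        where
        t : Carrier
        t = proj₁ (point-surjective X∈m X≢Q)
        X≡point-t : X ≡ point t
        X≡point-t = proj₂ (point-surjective X∈m X≢Q)

  injective-on-line⇒≤ : ∀ {P Q m n} → P ≢ Q → P ∈ m → Q ∈ m →
    {e : Fin n → Point} → Injective _≡_ _≡_ e → (∀ j → e j ∈ m) → n ≤ suc q
  injective-on-line⇒≤ {m = m} P≢Q P∈m Q∈m {e} =
    cover-injective⇒≤ {P = _∈ m} points points-cover {e = e}
    where open LineParametrisation P≢Q P∈m Q∈m

  cover-of-line⇒≥ : ∀ {P Q m k} → P ≢ Q → P ∈ m → Q ∈ m →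
    (s : Fin k → Point) → (∀ {X} → X ∈ m → ∃ λ i → X ≡ s i) → suc q ≤ k
  cover-of-line⇒≥ {m = m} P≢Q P∈m Q∈m s covers =
    cover-injective⇒≤ {P = _∈ m} s covers {e = points} points-injective points-∈
    where open LineParametrisation P≢Q P∈m Q∈m

module ConstructionGeometry {q} (F : FiniteField q) where
  open Plane F public

  TangentAt : PointSet → Line → Point → Set
  TangentAt S m P = S P × P ∈ m × (∀ {Y} → S Y → Y ∈ m → Y ≡ P)

  tangent⇒¬secant : ∀ {S m P} → TangentAt S m P → ¬ Secant S m
  tangent⇒¬secant (_ , _ , unique) (X , Y , X≢Y , SX , X∈m , SY , Y∈m) =
    X≢Y (trans (unique SX (incident X∈m)) (sym (unique SY (incident Y∈m))))

  two-tangents⇒¬r∞ : ∀ {S m m′ P} → TangentAt S m P → TangentAt S m′ P → m ≢ m′ → ¬ RInftyProperty S P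
  two-tangents⇒¬r∞ {m = m} {m′} tangent tangent′ m≢m′ (t , _ , secant) = cases (m ≟ₚ t)
    where
    cases : Dec (m ≡ t) → ⊥
    cases (yes m≡t) = tangent⇒¬secant tangent′
      (secant m′ (incidence (proj₁ (proj₂ tangent′))) λ m′≡t → m≢m′ (trans m≡t (sym m′≡t)))
    cases (no m≢t)  = tangent⇒¬secant tangent (secant m (incidence (proj₁ (proj₂ tangent))) m≢t)

  collinear-swap : ∀ {X Y Z} → Collinear X Y Z → Collinear X Z Y
  collinear-swap (m , X∈m , Y∈m , Z∈m) = m , X∈m , Z∈m , Y∈m

  -- The construction is symmetric under b ↔ c; for q odd the roles of D₁ and D₂ are exchanged.
  mirror : Construction → Construction
  mirror K = record
    { a = a ; b = c ; c = b
    ; nonConcurrent = λ X (X∈a , X∈c , X∈b) → nonConcurrent X (X∈a , X∈b , X∈c)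
    ; A = A ; B = C ; C = B
    ; C-on-a = B-on-a ; C-on-b = B-on-c ; B-on-a = C-on-a ; B-on-c = C-on-b
    ; A-on-b = A-on-c ; A-on-c = A-on-b
    ; ℓ = ℓ ; A-on-ℓ = A-on-ℓ ; ℓ≢b = ℓ≢c ; ℓ≢c = ℓ≢b
    ; A′ = A′ ; A′-on-ℓ = A′-on-ℓ ; A′-on-a = A′-on-a
    ; D = D ; D-injective = D-injective ; D-on-ℓ = D-on-ℓ ; D≢A = D≢A ; D≢A′ = D≢A′
    ; i₁ = i₂ ; i₂ = i₁ ; i₁≢i₂ = i₁≢i₂ ∘ sym
    ; odd-D₂ = λ q-odd →
        let B₁ , C₂ , (B₁∈b , B-D₁-B₁) , (C₂∈c , A′-B₁-C₂) , C-C₂-D₂ = odd-D₂ q-odd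
        in C₂ , B₁ , (C₂∈c , collinear-swap {C} {C₂} {D i₂} C-C₂-D₂) ,
           (B₁∈b , collinear-swap {A′} {B₁} {C₂} A′-B₁-C₂) , collinear-swap {B} {D i₁} {B₁} B-D₁-B₁
    }
    where open Construction K

  𝓑-mirror : ∀ K {X} → Construction.𝓑 K X → Construction.𝓑 (mirror K) X
  𝓑-mirror K {X} (in-𝓣-or-D , not-removed) = mirror-𝓣-or-D in-𝓣-or-D , not-removed ∘ mirror-removed
    where
    open Construction K
    module M = Construction (mirror K)
    mirror-𝓣-or-D : 𝓣 X ⊎ ∃[ i ] (X ≡ D i) → M.𝓣 X ⊎ ∃[ i ] (X ≡ D i)
    mirror-𝓣-or-D (inj₁ (inj₁ (X∈a , X∉b , X∉c)))         = inj₁ (inj₁ (X∈a , X∉c , X∉b))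
    mirror-𝓣-or-D (inj₁ (inj₂ (inj₁ (X∉a , X∈b , X∉c)))) = inj₁ (inj₂ (inj₂ (X∉a , X∉c , X∈b)))
    mirror-𝓣-or-D (inj₁ (inj₂ (inj₂ (X∉a , X∉b , X∈c)))) = inj₁ (inj₂ (inj₁ (X∉a , X∈c , X∉b)))
    mirror-𝓣-or-D (inj₂ X≡D)                             = inj₂ X≡D
    mirror-removed : M.Removed X → Removed X
    mirror-removed (i , removed) = i , swap removed

  module Configuration (2≤q : 2 ≤ q) (K : Construction) where
    open Construction K

    C∈a : C ∈ a
    C∈a = incident C-on-a
    C∈b : C ∈ b
    C∈b = incident C-on-b
    B∈a : B ∈ a
    B∈a = incident B-on-a
    B∈c : B ∈ c
    B∈c = incident B-on-c
    A∈b : A ∈ b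
    A∈b = incident A-on-b
    A∈c : A ∈ c
    A∈c = incident A-on-c
    A∈ℓ : A ∈ ℓ
    A∈ℓ = incident A-on-ℓ
    A′∈ℓ : A′ ∈ ℓ
    A′∈ℓ = incident A′-on-ℓ
    A′∈a : A′ ∈ a
    A′∈a = incident A′-on-a
    D∈ℓ : ∀ i → D i ∈ ℓ
    D∈ℓ i = incident (D-on-ℓ i)

    A∉a : ¬ A ∈ a
    A∉a A∈a = nonConcurrent A (incidence A∈a , A-on-b , A-on-c)

    B∉b : ¬ B ∈ b
    B∉b B∈b = nonConcurrent B (B-on-a , incidence B∈b , B-on-c)

    a≢b : a ≢ b
    a≢b a≡b = B∉b (subst (B ∈_) a≡b B∈a)

    a≢c : a ≢ c
    a≢c a≡c = A∉a (subst (A ∈_) (sym a≡c) A∈c)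

    ℓ≢a : ℓ ≢ a
    ℓ≢a ℓ≡a = A∉a (subst (A ∈_) ℓ≡a A∈ℓ)

    A≢B : A ≢ B
    A≢B A≡B = B∉b (subst (_∈ b) A≡B A∈b)

    A≢C : A ≢ C
    A≢C A≡C = A∉a (subst (_∈ a) (sym A≡C) C∈a)

    B≢C : B ≢ C
    B≢C B≡C = B∉b (subst (_∈ b) (sym B≡C) C∈b)

    A≢A′ : A ≢ A′
    A≢A′ A≡A′ = A∉a (subst (_∈ a) (sym A≡A′) A′∈a)

    ∈ℓ∩a⇒≡A′ : ∀ {X} → X ∈ ℓ → X ∈ a → X ≡ A′
    ∈ℓ∩a⇒≡A′ X∈ℓ X∈a = meet-unique ℓ≢a X∈ℓ X∈a A′∈ℓ A′∈a

    ∈ℓ∩b⇒≡A : ∀ {X} → X ∈ ℓ → X ∈ b → X ≡ A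
    ∈ℓ∩b⇒≡A X∈ℓ X∈b = meet-unique ℓ≢b X∈ℓ X∈b A∈ℓ A∈b

    ∈ℓ∩c⇒≡A : ∀ {X} → X ∈ ℓ → X ∈ c → X ≡ A
    ∈ℓ∩c⇒≡A X∈ℓ X∈c = meet-unique ℓ≢c X∈ℓ X∈c A∈ℓ A∈c

    B∉ℓ : ¬ B ∈ ℓ
    B∉ℓ B∈ℓ = A≢B (sym (∈ℓ∩c⇒≡A B∈ℓ B∈c))

    B≢A′ : B ≢ A′
    B≢A′ B≡A′ = B∉ℓ (subst (_∈ ℓ) (sym B≡A′) A′∈ℓ)

    A′∉c : ¬ A′ ∈ c
    A′∉c A′∈c = B≢A′ (sym (meet-unique a≢c A′∈a A′∈c B∈a B∈c))

    D∉a : ∀ i → ¬ D i ∈ a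
    D∉a i D∈a = D≢A′ i (∈ℓ∩a⇒≡A′ (D∈ℓ i) D∈a)

    D∉b : ∀ i → ¬ D i ∈ b
    D∉b i D∈b = D≢A i (∈ℓ∩b⇒≡A (D∈ℓ i) D∈b)

    D∉c : ∀ i → ¬ D i ∈ c
    D∉c i D∈c = D≢A i (∈ℓ∩c⇒≡A (D∈ℓ i) D∈c)

    D≢B : ∀ i → D i ≢ B
    D≢B i D≡B = B∉ℓ (subst (_∈ ℓ) D≡B (D∈ℓ i))

    data Shape (Y : Point) : Set where
      on-a : Y ∈ a → ¬ Y ∈ b → ¬ Y ∈ c → Shape Y
      on-b : ¬ Y ∈ a → Y ∈ b → ¬ Y ∈ c → (∀ i → ¬ Collinear B (D i) Y) → Shape Y
      on-c : ¬ Y ∈ a → ¬ Y ∈ b → Y ∈ c → (∀ i → ¬ Collinear C (D i) Y) → Shape Y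
      is-D : ∀ i → Y ≡ D i → Shape Y

    𝓑⊆Shape : ∀ {Y} → 𝓑 Y → Shape Y
    𝓑⊆Shape (inj₁ (inj₁ (Y∈a , Y∉b , Y∉c)) , _) =
      on-a (incident Y∈a) (Y∉b ∘ incidence) (Y∉c ∘ incidence)
    𝓑⊆Shape (inj₁ (inj₂ (inj₁ (Y∉a , Y∈b , Y∉c))) , not-removed) =
      on-b (Y∉a ∘ incidence) (incident Y∈b) (Y∉c ∘ incidence) λ i B-D-Y → not-removed (i , inj₁ (Y∈b , B-D-Y))
    𝓑⊆Shape (inj₁ (inj₂ (inj₂ (Y∉a , Y∉b , Y∈c))) , not-removed) =
      on-c (Y∉a ∘ incidence) (Y∉b ∘ incidence) (incident Y∈c) λ i C-D-Y → not-removed (i , inj₂ (Y∈c , C-D-Y))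
    𝓑⊆Shape (inj₂ (i , Y≡D) , _) = is-D i Y≡D

    record Free (E : Point) : Set where
      field
        E∈ℓ : E ∈ ℓ
        E≢A : E ≢ A
        E≢A′ : E ≢ A′
        E≢D : ∀ i → E ≢ D i

    2+[q∸2]≡q : 2 ℕ.+ (q ℕ.∸ 2) ≡ q
    2+[q∸2]≡q = ℕ.m+[n∸m]≡n 2≤q

    -- ℓ has q + 1 points, and A′, A and the D i are only q of them.
    ¬¬free : ¬ ¬ ∃ Free
    ¬¬free no-free = ℕ.<-irrefl (sym 2+[q∸2]≡q) (cover-of-line⇒≥ A≢A′ A∈ℓ A′∈ℓ (A′ ∷ A ∷ D) cover)
      where
      cover : ∀ {X} → X ∈ ℓ → ∃ λ i → X ≡ (A′ ∷ A ∷ D) i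
      cover {X} X∈ℓ = cases (X ≟ₚ A′) (X ≟ₚ A) (Fin.any? λ i → X ≟ₚ D i)
        where
        cases : Dec (X ≡ A′) → Dec (X ≡ A) → Dec (∃ λ i → X ≡ D i) → ∃ λ i → X ≡ (A′ ∷ A ∷ D) i
        cases (yes X≡A′) _          _                = zero , X≡A′
        cases (no _)     (yes X≡A)  _                = suc zero , X≡A
        cases (no _)     (no _)     (yes (i , X≡D)) = suc (suc i) , X≡D
        cases (no X≢A′)  (no X≢A)   (no X≢D)        = ⊥-elim (no-free (X , record
          { E∈ℓ = X∈ℓ ; E≢A = X≢A ; E≢A′ = X≢A′ ; E≢D = λ i X≡D → X≢D (i , X≡D) }))

    free-unique : ∀ {E E′} → Free E → Free E′ → E ≡ E′
    free-unique {E} {E′} free free′ = cases (E ≟ₚ E′)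
      where
      open Free free
      open Free free′ renaming (E∈ℓ to E′∈ℓ; E≢A to E′≢A; E≢A′ to E′≢A′; E≢D to E′≢D)
      cases : Dec (E ≡ E′) → E ≡ E′
      cases (yes E≡E′) = E≡E′
      cases (no E≢E′)  = ⊥-elim (ℕ.<-irrefl 2+[q∸2]≡q (ℕ.≤-pred
        (injective-on-line⇒≤ A≢A′ A∈ℓ A′∈ℓ {e = A′ ∷ A ∷ E ∷ E′ ∷ D} injective on-ℓ)))
        where
        injective : Injective _≡_ _≡_ (A′ ∷ A ∷ E ∷ E′ ∷ D)
        injective =
          ∷-injective (∷-injective (∷-injective (∷-injective D-injective
            λ i D≡E′ → E′≢D i (sym D≡E′))
            λ { zero → E≢E′ ∘ sym ; (suc i) D≡E → E≢D i (sym D≡E) })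
            λ { zero → E≢A ; (suc zero) → E′≢A ; (suc (suc i)) → D≢A i })
            λ { zero → A≢A′ ; (suc zero) → E≢A′ ; (suc (suc zero)) → E′≢A′ ; (suc (suc (suc i))) → D≢A′ i }
        on-ℓ : ∀ j → (A′ ∷ A ∷ E ∷ E′ ∷ D) j ∈ ℓ
        on-ℓ zero                      = A′∈ℓ
        on-ℓ (suc zero)                = A∈ℓ
        on-ℓ (suc (suc zero))          = E∈ℓ
        on-ℓ (suc (suc (suc zero)))    = E′∈ℓ
        on-ℓ (suc (suc (suc (suc i)))) = D∈ℓ i

    module _ {E} (free : Free E) where
      open Free free

      E∉a : ¬ E ∈ a
      E∉a E∈a = E≢A′ (∈ℓ∩a⇒≡A′ E∈ℓ E∈a)

      E∉b : ¬ E ∈ b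
      E∉b E∈b = E≢A (∈ℓ∩b⇒≡A E∈ℓ E∈b)

      B≢E : B ≢ E
      B≢E B≡E = B∉ℓ (subst (_∈ ℓ) (sym B≡E) E∈ℓ)

      BE : Line
      BE = join B≢E

      BE≢b : BE ≢ b
      BE≢b BE≡b = B∉b (subst (B ∈_) BE≡b (∈-joinˡ B≢E))

      b-point : Point
      b-point = meet BE≢b

      b-point-meet : IsMeet b-point B E A C
      b-point-meet = record
        { P≢Q = B≢E ; R≢S = A≢C ; m≢m′ = BE≢b
        ; P∈m = ∈-joinˡ B≢E ; Q∈m = ∈-joinʳ B≢E ; R∈m′ = A∈b ; S∈m′ = C∈b
        ; X∈m = ∈-meetˡ BE≢b ; X∈m′ = ∈-meetʳ BE≢b }

      -- The line through B and a point Y ∉ a, c meets ℓ in a point other than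
      -- A, A′ and the D i, which must be E.
      ∈BE : ∀ {Y} → ¬ Y ∈ a → ¬ Y ∈ c → (∀ i → ¬ Collinear B (D i) Y) → Y ∈ BE
      ∈BE {Y} Y∉a Y∉c not-collinear = subst (Y ∈_) BY≡BE (∈-joinʳ B≢Y)
        where
        B≢Y : B ≢ Y
        B≢Y B≡Y = Y∉c (subst (_∈ c) B≡Y B∈c)
        BY : Line
        BY = join B≢Y
        B∈BY : B ∈ BY
        B∈BY = ∈-joinˡ B≢Y
        Y∈BY : Y ∈ BY
        Y∈BY = ∈-joinʳ B≢Y
        BY≢ℓ : BY ≢ ℓ
        BY≢ℓ BY≡ℓ = B∉ℓ (subst (B ∈_) BY≡ℓ B∈BY)
        E″ : Point
        E″ = meet BY≢ℓ
        E″∈BY : E″ ∈ BY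
        E″∈BY = ∈-meetˡ BY≢ℓ
        free″ : Free E″
        free″ = record
          { E∈ℓ = ∈-meetʳ BY≢ℓ
          ; E≢A = λ E″≡A → Y∉c (subst (Y ∈_)
              (join-unique (A≢B ∘ sym) B∈BY (subst (_∈ BY) E″≡A E″∈BY) B∈c A∈c) Y∈BY)
          ; E≢A′ = λ E″≡A′ → Y∉a (subst (Y ∈_)
              (join-unique B≢A′ B∈BY (subst (_∈ BY) E″≡A′ E″∈BY) B∈a A′∈a) Y∈BY)
          ; E≢D = λ i E″≡D → not-collinear i
              (BY , incidence B∈BY , incidence (subst (_∈ BY) E″≡D E″∈BY) , incidence Y∈BY)
          }
        BY≡BE : BY ≡ BE
        BY≡BE = join-unique B≢E B∈BY (subst (_∈ BY) (free-unique free″ free) E″∈BY)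
          (∈-joinˡ B≢E) (∈-joinʳ B≢E)

    module _ (S : PointSet) (S⊆Shape : ∀ {Y} → S Y → Shape Y) where

      DB-tangent : ∀ i → S (D i) → TangentAt S (join (D≢B i)) (D i)
      DB-tangent i S-D = S-D , D∈n , unique
        where
        n : Line
        n = join (D≢B i)
        D∈n : D i ∈ n
        D∈n = ∈-joinˡ (D≢B i)
        B∈n : B ∈ n
        B∈n = ∈-joinʳ (D≢B i)
        n≢a : n ≢ a
        n≢a n≡a = D∉a i (subst (D i ∈_) n≡a D∈n)
        n≢c : n ≢ c
        n≢c n≡c = D∉c i (subst (D i ∈_) n≡c D∈n)
        n≢ℓ : n ≢ ℓ
        n≢ℓ n≡ℓ = B∉ℓ (subst (B ∈_) n≡ℓ B∈n)
        unique : ∀ {Y} → S Y → Y ∈ n → Y ≡ D i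
        unique {Y} SY Y∈n = by-shape (S⊆Shape SY)
          where
          by-shape : Shape Y → Y ≡ D i
          by-shape (on-a Y∈a _ Y∉c) =
            ⊥-elim (Y∉c (subst (_∈ c) (sym (meet-unique n≢a Y∈n Y∈a B∈n B∈a)) B∈c))
          by-shape (on-b _ _ _ not-collinear) =
            ⊥-elim (not-collinear i (n , incidence B∈n , incidence D∈n , incidence Y∈n))
          by-shape (on-c Y∉a _ Y∈c _) =
            ⊥-elim (Y∉a (subst (_∈ a) (sym (meet-unique n≢c Y∈n Y∈c B∈n B∈c)) B∈a))
          by-shape (is-D j Y≡D) =
            trans Y≡D (meet-unique n≢ℓ (subst (_∈ n) Y≡D Y∈n) (D∈ℓ j) D∈n (D∈ℓ i))

      module _ {P} (S-P : S P) (P∉a : ¬ P ∈ a) (P∈b : P ∈ b) (P∉c : ¬ P ∈ c)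
               (P-not-collinear : ∀ i → ¬ Collinear B (D i) P) where

        B≢P : B ≢ P
        B≢P B≡P = P∉c (subst (_∈ c) B≡P B∈c)

        BP-tangent : TangentAt S (join B≢P) P
        BP-tangent = S-P , P∈n , unique
          where
          n : Line
          n = join B≢P
          B∈n : B ∈ n
          B∈n = ∈-joinˡ B≢P
          P∈n : P ∈ n
          P∈n = ∈-joinʳ B≢P
          n≢a : n ≢ a
          n≢a n≡a = P∉a (subst (P ∈_) n≡a P∈n)
          n≢b : n ≢ b
          n≢b n≡b = B∉b (subst (B ∈_) n≡b B∈n)
          n≢c : n ≢ c
          n≢c n≡c = P∉c (subst (P ∈_) n≡c P∈n)
          unique : ∀ {Y} → S Y → Y ∈ n → Y ≡ P
          unique {Y} SY Y∈n = by-shape (S⊆Shape SY)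
            where
            by-shape : Shape Y → Y ≡ P
            by-shape (on-a Y∈a _ Y∉c) =
              ⊥-elim (Y∉c (subst (_∈ c) (sym (meet-unique n≢a Y∈n Y∈a B∈n B∈a)) B∈c))
            by-shape (on-b _ Y∈b _ _) = meet-unique n≢b Y∈n Y∈b P∈n P∈b
            by-shape (on-c Y∉a _ Y∈c _) =
              ⊥-elim (Y∉a (subst (_∈ a) (sym (meet-unique n≢c Y∈n Y∈c B∈n B∈c)) B∈a))
            by-shape (is-D j Y≡D) =
              ⊥-elim (P-not-collinear j (n , incidence B∈n , incidence (subst (_∈ n) Y≡D Y∈n) , incidence P∈n))

        b-tangent : ∀ {E} → Free E → TangentAt S b P
        b-tangent free = S-P , P∈b , unique
          where
          unique : ∀ {Y} → S Y → Y ∈ b → Y ≡ P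
          unique {Y} SY Y∈b = by-shape (S⊆Shape SY)
            where
            by-shape : Shape Y → Y ≡ P
            by-shape (on-a _ Y∉b _)   = ⊥-elim (Y∉b Y∈b)
            by-shape (on-b Y∉a _ Y∉c Y-not-collinear) = meet-unique (BE≢b free)
              (∈BE free Y∉a Y∉c Y-not-collinear) Y∈b (∈BE free P∉a P∉c P-not-collinear) P∈b
            by-shape (on-c _ Y∉b _ _) = ⊥-elim (Y∉b Y∈b)
            by-shape (is-D j Y≡D)     = ⊥-elim (D∉b j (subst (_∈ b) Y≡D Y∈b))

        on-b⇒¬r∞ : ∀ {E} → Free E → ¬ RInftyProperty S P
        on-b⇒¬r∞ free = two-tangents⇒¬r∞ BP-tangent (b-tangent free)
          λ BP≡b → B∉b (subst (B ∈_) BP≡b (∈-joinˡ B≢P))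

  module EveryPoint (4≤q : 4 ≤ q) (K : Construction) where
    open Construction K

    2≤q : 2 ≤ q
    2≤q = ℕ.≤-trans (ℕ.s≤s (ℕ.s≤s ℕ.z≤n)) 4≤q

    module B-side = Configuration 2≤q K
    module C-side = Configuration 2≤q (mirror K)
    open B-side using (Shape; on-a; on-b; on-c; is-D; Free; A∈b; A∈c; A∈ℓ; A′∈ℓ; A′∈a; B∈a; C∈a; C∈b; D∈ℓ)

    𝓑⊆C-side-Shape : ∀ {Y} → 𝓑 Y → C-side.Shape Y
    𝓑⊆C-side-Shape = C-side.𝓑⊆Shape ∘ 𝓑-mirror K

    D⇒¬r∞ : ∀ i → 𝓑 (D i) → ¬ RInftyProperty 𝓑 (D i)
    D⇒¬r∞ i 𝓑-D = two-tangents⇒¬r∞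
      (B-side.DB-tangent 𝓑 B-side.𝓑⊆Shape i 𝓑-D) (C-side.DB-tangent 𝓑 𝓑⊆C-side-Shape i 𝓑-D) DB≢DC
      where
      DB≢DC : join (B-side.D≢B i) ≢ join (C-side.D≢B i)
      DB≢DC DB≡DC = B-side.D∉a i (subst (D i ∈_)
        (join-unique B-side.B≢C (∈-joinʳ (B-side.D≢B i))
          (subst (C ∈_) (sym DB≡DC) (∈-joinʳ (C-side.D≢B i))) B∈a C∈a)
        (∈-joinˡ (B-side.D≢B i)))

    module _ {E} (free : Free E) where
      open Free free

      free-mirror : C-side.Free E
      free-mirror = record { E∈ℓ = E∈ℓ ; E≢A = E≢A ; E≢A′ = E≢A′ ; E≢D = E≢D }

      on-a⇒¬r∞ : ∀ {P} → 𝓑 P → P ∈ a → ¬ P ∈ b → ¬ P ∈ c → P ≢ A′ → ¬ RInftyProperty 𝓑 P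
      on-a⇒¬r∞ {P} 𝓑-P P∈a P∉b P∉c P≢A′ = two-tangents⇒¬r∞ AP-tangent EP-tangent AP≢EP
        where
        P∉ℓ : ¬ P ∈ ℓ
        P∉ℓ P∈ℓ = P≢A′ (B-side.∈ℓ∩a⇒≡A′ P∈ℓ P∈a)
        P≢A : P ≢ A
        P≢A P≡A = B-side.A∉a (subst (_∈ a) P≡A P∈a)
        P≢E : P ≢ E
        P≢E P≡E = P∉ℓ (subst (_∈ ℓ) (sym P≡E) E∈ℓ)
        AP EP : Line
        AP = join P≢A
        EP = join P≢E
        AP≢EP : AP ≢ EP
        AP≢EP AP≡EP = P∉ℓ (subst (P ∈_)
          (join-unique (E≢A ∘ sym) (subst (A ∈_) AP≡EP (∈-joinʳ P≢A)) (∈-joinʳ P≢E) A∈ℓ E∈ℓ)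
          (∈-joinˡ P≢E))
        AP-tangent : TangentAt 𝓑 AP P
        AP-tangent = 𝓑-P , ∈-joinˡ P≢A , unique
          where
          A∈AP : A ∈ AP
          A∈AP = ∈-joinʳ P≢A
          P∈AP : P ∈ AP
          P∈AP = ∈-joinˡ P≢A
          AP≢a : AP ≢ a
          AP≢a AP≡a = B-side.A∉a (subst (A ∈_) AP≡a A∈AP)
          AP≢b : AP ≢ b
          AP≢b AP≡b = P∉b (subst (P ∈_) AP≡b P∈AP)
          AP≢c : AP ≢ c
          AP≢c AP≡c = P∉c (subst (P ∈_) AP≡c P∈AP)
          AP≢ℓ : AP ≢ ℓ
          AP≢ℓ AP≡ℓ = P∉ℓ (subst (P ∈_) AP≡ℓ P∈AP)
          unique : ∀ {Y} → 𝓑 Y → Y ∈ AP → Y ≡ P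
          unique {Y} 𝓑-Y Y∈AP = by-shape (B-side.𝓑⊆Shape 𝓑-Y)
            where
            by-shape : Shape Y → Y ≡ P
            by-shape (on-a Y∈a _ _) = meet-unique AP≢a Y∈AP Y∈a P∈AP P∈a
            by-shape (on-b _ Y∈b Y∉c _) =
              ⊥-elim (Y∉c (subst (_∈ c) (sym (meet-unique AP≢b Y∈AP Y∈b A∈AP A∈b)) A∈c))
            by-shape (on-c _ Y∉b Y∈c _) =
              ⊥-elim (Y∉b (subst (_∈ b) (sym (meet-unique AP≢c Y∈AP Y∈c A∈AP A∈c)) A∈b))
            by-shape (is-D j Y≡D) =
              ⊥-elim (D≢A j (meet-unique AP≢ℓ (subst (_∈ AP) Y≡D Y∈AP) (D∈ℓ j) A∈AP A∈ℓ))
        EP-tangent : TangentAt 𝓑 EP P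
        EP-tangent = 𝓑-P , P∈EP , unique
          where
          P∈EP : P ∈ EP
          P∈EP = ∈-joinˡ P≢E
          E∈EP : E ∈ EP
          E∈EP = ∈-joinʳ P≢E
          EP≢a : EP ≢ a
          EP≢a EP≡a = B-side.E∉a free (subst (E ∈_) EP≡a E∈EP)
          EP≢ℓ : EP ≢ ℓ
          EP≢ℓ EP≡ℓ = P∉ℓ (subst (P ∈_) EP≡ℓ P∈EP)
          -- A point Y ≢ E on EP and on a line VE makes EP = VE, which contains V and P, so EP = a.
          ¬∈EP : ∀ {V Y} → V ∈ a → V ≢ P → ∀ {VE} → V ∈ VE → E ∈ VE → Y ∈ VE → Y ≢ E → ¬ Y ∈ EP
          ¬∈EP V∈a V≢P V∈VE E∈VE Y∈VE Y≢E Y∈EP = EP≢a (join-unique V≢P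
            (subst (_ ∈_) (join-unique Y≢E Y∈VE E∈VE Y∈EP E∈EP) V∈VE) P∈EP V∈a P∈a)
          unique : ∀ {Y} → 𝓑 Y → Y ∈ EP → Y ≡ P
          unique {Y} 𝓑-Y Y∈EP = by-shape (B-side.𝓑⊆Shape 𝓑-Y)
            where
            by-shape : Shape Y → Y ≡ P
            by-shape (on-a Y∈a _ _) = meet-unique EP≢a Y∈EP Y∈a P∈EP P∈a
            by-shape (on-b Y∉a Y∈b Y∉c Y-not-collinear) =
              ⊥-elim (¬∈EP B∈a (λ B≡P → P∉c (subst (_∈ c) B≡P B-side.B∈c))
              (∈-joinˡ (B-side.B≢E free)) (∈-joinʳ (B-side.B≢E free))
              (B-side.∈BE free Y∉a Y∉c Y-not-collinear)
              (λ Y≡E → B-side.E∉b free (subst (_∈ b) Y≡E Y∈b)) Y∈EP)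
            by-shape (on-c Y∉a Y∉b Y∈c Y-not-collinear) =
              ⊥-elim (¬∈EP C∈a (λ C≡P → P∉b (subst (_∈ b) C≡P C∈b))
              (∈-joinˡ (C-side.B≢E free-mirror)) (∈-joinʳ (C-side.B≢E free-mirror))
              (C-side.∈BE free-mirror Y∉a Y∉b Y-not-collinear)
              (λ Y≡E → C-side.E∉b free-mirror (subst (_∈ c) Y≡E Y∈c)) Y∈EP)
            by-shape (is-D j Y≡D) =
              ⊥-elim (E≢D j (meet-unique EP≢ℓ E∈EP E∈ℓ (subst (_∈ EP) Y≡D Y∈EP) (D∈ℓ j)))

      A′-meet : IsMeet A′ A E B C
      A′-meet = record
        { P≢Q = E≢A ∘ sym ; R≢S = B-side.B≢C ; m≢m′ = B-side.ℓ≢a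
        ; P∈m = A∈ℓ ; Q∈m = E∈ℓ ; R∈m′ = B∈a ; S∈m′ = C∈a ; X∈m = A′∈ℓ ; X∈m′ = A′∈a }

      module A′-case (t : Line) (A′∈t : A′ ∈ t) (secant : ∀ m → A′ on m → m ≢ t → Secant 𝓑 m) where
        A′∉b : ¬ A′ ∈ b
        A′∉b = C-side.A′∉c

        t≢b : t ≢ b
        t≢b t≡b = A′∉b (subst (A′ ∈_) t≡b A′∈t)

        Xt Bb Cc : Point
        Xt = meet t≢b
        Bb = B-side.b-point free
        Cc = C-side.b-point free-mirror

        A′≢Cc : A′ ≢ Cc
        A′≢Cc A′≡Cc = B-side.A′∉c (subst (_∈ c) (sym A′≡Cc) (∈-meetʳ (C-side.BE≢b free-mirror)))

        A′Cc≢b : join A′≢Cc ≢ b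
        A′Cc≢b A′Cc≡b = A′∉b (subst (A′ ∈_) A′Cc≡b (∈-joinˡ A′≢Cc))

        X₀ : Point
        X₀ = meet A′Cc≢b

        five : Fin 5 → Point
        five = C ∷ A ∷ Xt ∷ Bb ∷ X₀ ∷ []

        via-second-point : ∀ {X Y n} → X ∈ b → X ≢ C → X ≢ A → A′ ∈ n → X ∈ n →
                           𝓑 Y → Y ≢ A′ → Y ∈ n → ∃ λ i → X ≡ five i
        via-second-point {X} {Y} {n} X∈b X≢C X≢A A′∈n X∈n 𝓑-Y Y≢A′ Y∈n = by-shape (B-side.𝓑⊆Shape 𝓑-Y)
          where
          n≢b : n ≢ b
          n≢b n≡b = A′∉b (subst (A′ ∈_) n≡b A′∈n)
          by-shape : Shape Y → ∃ λ i → X ≡ five i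
          by-shape (on-a Y∈a _ _) = ⊥-elim (X≢C (meet-unique B-side.a≢b
            (subst (X ∈_) (join-unique Y≢A′ Y∈n A′∈n Y∈a A′∈a) X∈n) X∈b C∈a C∈b))
          by-shape (on-b Y∉a Y∈b Y∉c Y-not-collinear) = suc (suc (suc zero)) ,
            meet-unique (B-side.BE≢b free)
              (subst (_∈ B-side.BE free) (meet-unique n≢b Y∈n Y∈b X∈n X∈b)
                (B-side.∈BE free Y∉a Y∉c Y-not-collinear))
              X∈b (∈-meetˡ (B-side.BE≢b free)) (∈-meetʳ (B-side.BE≢b free))
          by-shape (on-c Y∉a Y∉b Y∈c Y-not-collinear) = suc (suc (suc (suc zero))) ,
            meet-unique A′Cc≢b (subst (X ∈_) n≡A′Cc X∈n) X∈b (∈-meetˡ A′Cc≢b) (∈-meetʳ A′Cc≢b)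
            where
            Y≡Cc : Y ≡ Cc
            Y≡Cc = meet-unique (C-side.BE≢b free-mirror) (C-side.∈BE free-mirror Y∉a Y∉b Y-not-collinear) Y∈c
              (∈-meetˡ (C-side.BE≢b free-mirror)) (∈-meetʳ (C-side.BE≢b free-mirror))
            n≡A′Cc : n ≡ join A′≢Cc
            n≡A′Cc = join-unique A′≢Cc A′∈n (subst (_∈ n) Y≡Cc Y∈n) (∈-joinˡ A′≢Cc) (∈-joinʳ A′≢Cc)
          by-shape (is-D j Y≡D) = ⊥-elim (X≢A (B-side.∈ℓ∩b⇒≡A (subst (X ∈_) n≡ℓ X∈n) X∈b))
            where
            n≡ℓ : n ≡ ℓ
            n≡ℓ = join-unique Y≢A′ Y∈n A′∈n (subst (_∈ ℓ) (sym Y≡D) (D∈ℓ j)) A′∈ℓ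

        b-cover : ∀ {X} → X ∈ b → ∃ λ i → X ≡ five i
        b-cover {X} X∈b = cases (X ≟ₚ C) (X ≟ₚ A)
          where
          cases : Dec (X ≡ C) → Dec (X ≡ A) → ∃ λ i → X ≡ five i
          cases (yes X≡C) _         = zero , X≡C
          cases (no _)    (yes X≡A) = suc zero , X≡A
          cases (no X≢C)  (no X≢A)  = through-A′X (join A′≢X ≟ₚ t)
            where
            A′≢X : A′ ≢ X
            A′≢X A′≡X = A′∉b (subst (_∈ b) (sym A′≡X) X∈b)
            A′∈n : A′ ∈ join A′≢X
            A′∈n = ∈-joinˡ A′≢X
            X∈n : X ∈ join A′≢X
            X∈n = ∈-joinʳ A′≢X
            second-point : Secant 𝓑 (join A′≢X) → ∃ λ i → X ≡ five i
            second-point (Y₁ , Y₂ , Y₁≢Y₂ , 𝓑-Y₁ , Y₁∈n , 𝓑-Y₂ , Y₂∈n) = pick (Y₁ ≟ₚ A′)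
              where
              pick : Dec (Y₁ ≡ A′) → ∃ λ i → X ≡ five i
              pick (yes Y₁≡A′) = via-second-point X∈b X≢C X≢A A′∈n X∈n 𝓑-Y₂
                (λ Y₂≡A′ → Y₁≢Y₂ (trans Y₁≡A′ (sym Y₂≡A′))) (incident Y₂∈n)
              pick (no Y₁≢A′)  = via-second-point X∈b X≢C X≢A A′∈n X∈n 𝓑-Y₁ Y₁≢A′ (incident Y₁∈n)
            through-A′X : Dec (join A′≢X ≡ t) → ∃ λ i → X ≡ five i
            through-A′X (yes n≡t) = suc (suc zero) ,
              meet-unique t≢b (subst (X ∈_) n≡t X∈n) X∈b (∈-meetˡ t≢b) (∈-meetʳ t≢b)
            through-A′X (no n≢t)  = second-point (secant (join A′≢X) (incidence A′∈n) n≢t)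

        q≡4 : q ≡ 4
        q≡4 = ℕ.≤-antisym (ℕ.≤-pred (cover-of-line⇒≥ B-side.A≢C A∈b C∈b five b-cover)) 4≤q

        X₀≡Bb : X₀ ≡ Bb
        X₀≡Bb = meet-unique A′Bb≢b (subst (X₀ ∈_) A′Cc≡A′Bb (∈-meetˡ A′Cc≢b)) (∈-meetʳ A′Cc≢b)
          (∈-joinʳ A′≢Bb) (∈-meetʳ (B-side.BE≢b free))
          where
          A′≢Bb : A′ ≢ Bb
          A′≢Bb A′≡Bb = A′∉b (subst (_∈ b) (sym A′≡Bb) (∈-meetʳ (B-side.BE≢b free)))
          A′Bb≢b : join A′≢Bb ≢ b
          A′Bb≢b A′Bb≡b = A′∉b (subst (A′ ∈_) A′Bb≡b (∈-joinˡ A′≢Bb))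
          Cc∈A′Bb : Cc ∈ join A′≢Bb
          Cc∈A′Bb = fano (order-4⇒char-2 q≡4) A′-meet (B-side.b-point-meet free) (C-side.b-point-meet free-mirror)
            A′≢Bb (∈-joinˡ A′≢Bb) (∈-joinʳ A′≢Bb)
          A′Cc≡A′Bb : join A′≢Cc ≡ join A′≢Bb
          A′Cc≡A′Bb = join-unique A′≢Cc (∈-joinˡ A′≢Cc) (∈-joinʳ A′≢Cc) (∈-joinˡ A′≢Bb) Cc∈A′Bb

        four-cover : ∀ {X} → X ∈ b → ∃ λ i → X ≡ (C ∷ A ∷ Xt ∷ Bb ∷ []) i
        four-cover X∈b = shrink (b-cover X∈b)
          where
          shrink : ∀ {X} → ∃ (λ i → X ≡ five i) → ∃ λ i → X ≡ (C ∷ A ∷ Xt ∷ Bb ∷ []) i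
          shrink (zero , X≡C)                      = zero , X≡C
          shrink (suc zero , X≡A)                  = suc zero , X≡A
          shrink (suc (suc zero) , X≡Xt)           = suc (suc zero) , X≡Xt
          shrink (suc (suc (suc zero)) , X≡Bb)     = suc (suc (suc zero)) , X≡Bb
          shrink (suc (suc (suc (suc zero))) , X≡X₀) = suc (suc (suc zero)) , trans X≡X₀ X₀≡Bb

        contradiction : ⊥
        contradiction = ℕ.n≮n q (ℕ.≤-trans (cover-of-line⇒≥ B-side.A≢C A∈b C∈b _ four-cover) 4≤q)

      A′⇒¬r∞ : ¬ RInftyProperty 𝓑 A′
      A′⇒¬r∞ (t , (A′-on-t , _) , secant) = A′-case.contradiction t (incident A′-on-t) secant

      ¬r∞ : ∀ {P} → 𝓑 P → ¬ RInftyProperty 𝓑 P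
      ¬r∞ {P} 𝓑-P = by-shape (B-side.𝓑⊆Shape 𝓑-P)
        where
        by-shape : Shape P → ¬ RInftyProperty 𝓑 P
        by-shape (on-a P∈a P∉b P∉c) = on-a-cases (P ≟ₚ A′)
          where
          on-a-cases : Dec (P ≡ A′) → ¬ RInftyProperty 𝓑 P
          on-a-cases (yes P≡A′) = subst (¬_ ∘ RInftyProperty 𝓑) (sym P≡A′) A′⇒¬r∞
          on-a-cases (no P≢A′)  = on-a⇒¬r∞ 𝓑-P P∈a P∉b P∉c P≢A′
        by-shape (on-b P∉a P∈b P∉c P-not-collinear) =
          B-side.on-b⇒¬r∞ 𝓑 B-side.𝓑⊆Shape 𝓑-P P∉a P∈b P∉c P-not-collinear free
        by-shape (on-c P∉a P∉b P∈c P-not-collinear) =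
          C-side.on-b⇒¬r∞ 𝓑 𝓑⊆C-side-Shape 𝓑-P P∉a P∈c P∉b P-not-collinear free-mirror
        by-shape (is-D i P≡D) = subst (λ X → 𝓑 X → ¬ RInftyProperty 𝓑 X) (sym P≡D) (D⇒¬r∞ i) 𝓑-P

lemma3p9 : ∀ {q} (F : FiniteField q) → IsPrimePower q → 4 ≤ q →
    (K : PG2.Construction F) →
    ∀ P → PG2.Construction.𝓑 K P → ¬ PG2.RInftyProperty F (PG2.Construction.𝓑 K) P
lemma3p9 F _ 4≤q K P 𝓑-P r∞ = B-side.¬¬free λ (E , free) → ¬r∞ free 𝓑-P r∞
  where open ConstructionGeometry.EveryPoint F 4≤q K
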